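{- Let $\mathcal{L}\in\{\mathtt{M},\mathtt{ME}^\infty\}$ and $B\subseteq A$. There is an effective translation $(\cdot)^\ominus$ from $\mathcal{L}(A)$-sentences to syntactically $B$-continuous $\mathcal{L}(A)$-sentences such that a sentence $\phi\in\mathcal{L}(A)$ is continuous in $B$ if and only if $\phi\equiv\phi^\ominus$.
   Context: Fix a finite set $A$ of monadic predicate symbols. A monadic model is $(D,V)$, $D$ a set (possibly empty), $V:A\to\wp(D)$. $\mathtt{ME}^\infty(A)$: $\varphi::=\top\mid\bot\mid a(x)\mid\neg a(x)\mid x\approx y\mid x\not\approx y\mid\varphi\vee\varphi\mid\varphi\wedge\varphi\mid\exists x.\varphi\mid\forall x.\varphi\mid\exists^\infty x.\varphi\mid\forall^\infty x.\varphi$; $\mathtt{M}(A)$ omits $\exists^\infty,\forall^\infty,\approx,\not\approx$. Standard semantics on nonempty models ($\exists^\infty$: infinitely many, $\forall^\infty$: all but finitely many); on the empty model $\exists,\exists^\infty$-sentences false, $\forall,\forall^\infty$-sentences true. $\equiv$: truth in the same models. $U\le_B V$ iff $U(b)\subseteq V(b)$ ($b\in B$) and $U(a)=V(a)$ ($a\notin B$); $U\le^\omega_B V$ iff additionally each $U(b)$, $b\in B$, is finite. $\phi$ is monotone in $B$ if $(D,V),g\models\phi$, $V\le_B V'$ imply $(D,V'),g\models\phi$; continuous in $B$ if monotone in $B$ and $(D,V),g\models\phi$ implies $(D,U),g\models\phi$ for some $U\le^\omega_B V$. Syntactically $B$-continuous formulas of $\mathtt{M}(A)$: $\phi::=\psi\mid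 b(x)\mid\phi\wedge\phi\mid\phi\vee\phi\mid\exists x.\phi$, $b\in B$, $\psi\in\mathtt{M}(A\setminus B)$. With $\mathbf{W}x.(\phi,\psi):=\forall x.(\phi(x)\vee\psi(x))\wedge\forall^\infty x.\psi(x)$, those of $\mathtt{ME}^\infty(A)$: $\phi::=\psi\mid b(x)\mid\phi\wedge\phi\mid\phi\vee\phi\mid\exists x.\phi\mid\mathbf{W}x.(\phi,\psi)$, $b\in B$, $\psi\in\mathtt{ME}^\infty(A\setminus B)$. -}

module Defs where

open import Level using (0ℓ)
open import Data.Nat using (ℕ; zero; suc)
open import Data.Fin using (Fin)
open import Data.Fin.Subset using (Subset; _∈_; _∉_)
open import Data.List using (List)
open import Data.List.Membership.Propositional using () renaming (_∈_ to _∈ₗ_)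
open import Data.Product using (Σ; ∃; _×_; _,_)
open import Data.Sum using (_⊎_)
open import Data.Unit using (⊤)
open import Data.Empty using (⊥)
open import Relation.Nullary using (¬_)
open import Relation.Binary.PropositionalEquality using (_≡_)
open import Function.Bundles using (_⇔_)

data Lang : Set where
  M MEinf : Lang

-- Syntax.  The set A of monadic predicate symbols is Fin k.
-- Variables are de Bruijn indices: Formula k L n has free variables
-- among Fin n; sentences are Formula k L 0.

data Formula (k : ℕ) : Lang → ℕ → Set where
  tt ff   : ∀ {L n} → Formula k L n
  pos     : ∀ {L n} → Fin k → Fin n → Formula k L n
  neg     : ∀ {L n} → Fin k → Fin n → Formula k L n
  eq      : ∀ {n} → Fin n → Fin n → Formula k MEinf n
  neq     : ∀ {n} → Fin n → Fin n → Formula k MEinf n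
  _∨f_    : ∀ {L n} → Formula k L n → Formula k L n → Formula k L n
  _∧f_    : ∀ {L n} → Formula k L n → Formula k L n → Formula k L n
  ex      : ∀ {L n} → Formula k L (suc n) → Formula k L n
  all     : ∀ {L n} → Formula k L (suc n) → Formula k L n
  exInf   : ∀ {n} → Formula k MEinf (suc n) → Formula k MEinf n
  allInf  : ∀ {n} → Formula k MEinf (suc n) → Formula k MEinf n

Sentence : ℕ → Lang → Set
Sentence k L = Formula k L 0

-- Models (D may be empty); V : A → ℘(D), subsets as predicates.

record Model (k : ℕ) : Set₁ where
  constructor model
  field
    D : Set
    V : Fin k → D → Set
open Model public

Finite : {D : Set} → (D → Set) → Set
Finite {D} P = Σ (List D) λ xs → ∀ d → P d → d ∈ₗ xs

ext : {D : Set} {n : ℕ} → (Fin n → D) → D → Fin (suc n) → D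
ext g d Fin.zero    = d
ext g d (Fin.suc i) = g i

Sat : ∀ {k L n} (𝔐 : Model k) → (Fin n → D 𝔐) → Formula k L n → Set
Sat 𝔐 g tt          = ⊤
Sat 𝔐 g ff          = ⊥
Sat 𝔐 g (pos a x)   = V 𝔐 a (g x)
Sat 𝔐 g (neg a x)   = ¬ V 𝔐 a (g x)
Sat 𝔐 g (eq x y)    = g x ≡ g y
Sat 𝔐 g (neq x y)   = ¬ (g x ≡ g y)
Sat 𝔐 g (φ ∨f ψ)    = Sat 𝔐 g φ ⊎ Sat 𝔐 g ψ
Sat 𝔐 g (φ ∧f ψ)    = Sat 𝔐 g φ × Sat 𝔐 g ψ
Sat 𝔐 g (ex φ)      = Σ (D 𝔐) λ d → Sat 𝔐 (ext g d) φ
Sat 𝔐 g (all φ)     = (d : D 𝔐) → Sat 𝔐 (ext g d) φ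
Sat 𝔐 g (exInf φ)   = ¬ Finite (λ d → Sat 𝔐 (ext g d) φ)
Sat 𝔐 g (allInf φ)  = Finite (λ d → ¬ Sat 𝔐 (ext g d) φ)

Sat₀ : ∀ {k L} → Model k → Sentence k L → Set
Sat₀ 𝔐 φ = Sat 𝔐 (λ ()) φ

_≡ₛ_ : ∀ {k L} → Sentence k L → Sentence k L → Set₁
φ ≡ₛ ψ = ∀ (𝔐 : Model _) → Sat₀ 𝔐 φ ⇔ Sat₀ 𝔐 ψ

_≤[_]_ : ∀ {k} {D : Set} → (Fin k → D → Set) → Subset k → (Fin k → D → Set) → Set
U ≤[ B ] W = (∀ b → b ∈ B → ∀ d → U b d → W b d)
           × (∀ a → a ∉ B → ∀ d → U a d ⇔ W a d)

_≤ω[_]_ : ∀ {k} {D : Set} → (Fin k → D → Set) → Subset k → (Fin k → D → Set) → Set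
U ≤ω[ B ] W = U ≤[ B ] W × (∀ b → b ∈ B → Finite (U b))

Monotone : ∀ {k L n} → Subset k → Formula k L n → Set₁
Monotone {k} B φ = ∀ (D : Set) (V V′ : Fin k → D → Set) g →
  Sat (model D V) g φ → V ≤[ B ] V′ → Sat (model D V′) g φ

Continuous : ∀ {k L n} → Subset k → Formula k L n → Set₁
Continuous {k} B φ = Monotone B φ ×
  (∀ (D : Set) (V : Fin k → D → Set) g → Sat (model D V) g φ →
     Σ (Fin k → D → Set) λ U → U ≤ω[ B ] V × Sat (model D U) g φ)

data Free {k : ℕ} (B : Subset k) : ∀ {L n} → Formula k L n → Set where
  tt     : ∀ {L n} → Free B (tt {L = L} {n = n})
  ff     : ∀ {L n} → Free B (ff {L = L} {n = n})
  pos    : ∀ {L n} a (x : Fin n) → a ∉ B → Free B (pos {L = L} a x)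
  neg    : ∀ {L n} a (x : Fin n) → a ∉ B → Free B (neg {L = L} a x)
  eq     : ∀ {n} (x y : Fin n) → Free B (eq x y)
  neq    : ∀ {n} (x y : Fin n) → Free B (neq x y)
  _∨f_   : ∀ {L n} {φ ψ : Formula k L n} → Free B φ → Free B ψ → Free B (φ ∨f ψ)
  _∧f_   : ∀ {L n} {φ ψ : Formula k L n} → Free B φ → Free B ψ → Free B (φ ∧f ψ)
  ex     : ∀ {L n} {φ : Formula k L (suc n)} → Free B φ → Free B (ex φ)
  all    : ∀ {L n} {φ : Formula k L (suc n)} → Free B φ → Free B (all φ)
  exInf  : ∀ {n} {φ : Formula k MEinf (suc n)} → Free B φ → Free B (exInf φ)
  allInf : ∀ {n} {φ : Formula k MEinf (suc n)} → Free B φ → Free B (allInf φ)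

Wq : ∀ {k n} → Formula k MEinf (suc n) → Formula k MEinf (suc n) → Formula k MEinf n
Wq φ ψ = all (φ ∨f ψ) ∧f allInf ψ

data SynCont {k : ℕ} (B : Subset k) : ∀ {L n} → Formula k L n → Set where
  base : ∀ {L n} {ψ : Formula k L n} → Free B ψ → SynCont B ψ
  pos  : ∀ {L n} b (x : Fin n) → b ∈ B → SynCont B (pos {L = L} b x)
  _∧c_ : ∀ {L n} {φ ψ : Formula k L n} → SynCont B φ → SynCont B ψ → SynCont B (φ ∧f ψ)
  _∨c_ : ∀ {L n} {φ ψ : Formula k L n} → SynCont B φ → SynCont B ψ → SynCont B (φ ∨f ψ)
  ex   : ∀ {L n} {φ : Formula k L (suc n)} → SynCont B φ → SynCont B (ex φ)
  W    : ∀ {n} {φ ψ : Formula k MEinf (suc n)} → SynCont B φ → Free B ψ → SynCont B (Wq φ ψ)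

-- Syntactically B-continuous formulas are continuous, by induction on the grammar; for
-- W x.(φ , ψ) only the finitely many points failing ψ need a finite witness for φ.
-- Conversely, t φ is a finite disjunction over descriptions of a valuation U ≤ω V by atomic
-- types: each disjunct says, using B-free formulas and positive B-atoms only, that V has
-- points carrying the described B-parts and that φ holds in the described model, so it
-- implies φ whenever φ is monotone in B. If φ is continuous and true, it is already true
-- under some U ≤ω V, and the disjunct describing U holds: in M a model is determined, up to a
-- total and surjective atom-preserving relation, by its set of realised types; in ME∞ by the
-- number of points of each type counted up to the quantifier depth q of φ (a counting
-- Ehrenfeucht–Fraïssé game).

module Submission where

open import Defs
open import Level using (0ℓ)
open import Axiom.ExcludedMiddle using (ExcludedMiddle)
open import Data.Bool using (Bool; true; false; if_then_else_)
open import Data.Bool.Properties using () renaming (_≟_ to _≟B_)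
open import Data.Empty using (⊥; ⊥-elim)
open import Data.Fin using (Fin; zero; suc; inject≤; punchIn; _↑ˡ_; _↑ʳ_) renaming (_≟_ to _≟F_)
open import Data.Fin.Properties using (suc-injective; inject≤-injective; punchIn-injective; punchInᵢ≢i)
open import Data.Fin.Subset using (Subset; _∈_; _∉_)
open import Data.Fin.Subset.Properties using (_∈?_)
import Data.List as List
open import Data.List using (List; []; _∷_; _++_; map; concatMap; length; filter) renaming (lookup to lookupₗ)
open import Data.List.Properties using (map-++; map-concatMap; length-map; length-++; length-tabulate)
open import Data.List.Membership.Propositional using () renaming (_∈_ to _∈ₗ_)
open import Data.List.Membership.Propositional.Properties using (∈-++⁺ˡ; ∈-++⁺ʳ; ∈-++⁻; ∈-map⁺; ∈-map⁻; ∈-lookup; ∈-filter⁺; ∈-filter⁻; ∈-tabulate⁻)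
open import Data.List.Relation.Unary.All using (All; all?) renaming (lookup to lookupA; tabulate to tabulateA)
open import Data.List.Relation.Unary.Any using (here; there; index)
open import Data.List.Relation.Unary.Any.Properties using (lookup-index)
open import Data.Nat using (ℕ; zero; suc; _+_; _*_; _≤_; _<_; _⊔_; s≤s; z≤n; _≤?_)
open import Data.Nat.Properties using (≤-refl; ≤-trans; ≤-reflexive; <-irrefl; <⇒≤; m≤m+n; m≤n+m; m≤m⊔n; m≤n⊔m; n≤1+n; +-mono-≤)
open import Data.Product using (Σ; _×_; _,_; proj₁; proj₂)
open import Data.Sum using (_⊎_; inj₁; inj₂; [_,_]; [_,_]′)
open import Data.Unit using (⊤; tt)
open import Data.Vec using (Vec; []; _∷_; lookup; tabulate)
open import Data.Vec.Properties using (lookup∘tabulate; ≡-dec)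
open import Function.Bundles using (_⇔_; mk⇔; Equivalence)
open import Relation.Nullary using (¬_; Dec; yes; no; does)
open import Relation.Unary using (Decidable)
open import Relation.Binary.PropositionalEquality using (_≡_; refl; sym; trans; cong; cong₂; subst)

infix 2 _⟺_
_⟺_ : ∀ {a b} → Set a → Set b → Set _
A ⟺ B = (A → B) × (B → A)

⟺-refl : ∀ {a} {A : Set a} → A ⟺ A
⟺-refl = (λ x → x) , (λ x → x)
⟺-sym : ∀ {a b} {A : Set a} {B : Set b} → A ⟺ B → B ⟺ A
⟺-sym (f , g) = g , f
⟺-trans : ∀ {a b c} {A : Set a} {B : Set b} {C : Set c} → A ⟺ B → B ⟺ C → A ⟺ C
⟺-trans (f , g) (h , i) = (λ x → h (f x)) , (λ x → g (i x))
⊎-cong : ∀ {A B C E : Set} → A ⟺ C → B ⟺ E → (A ⊎ B) ⟺ (C ⊎ E)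
⊎-cong (f , g) (h , i) = [ (λ x → inj₁ (f x)) , (λ x → inj₂ (h x)) ] , [ (λ x → inj₁ (g x)) , (λ x → inj₂ (i x)) ]
×-cong : ∀ {A B C E : Set} → A ⟺ C → B ⟺ E → (A × B) ⟺ (C × E)
×-cong (f , g) (h , i) = (λ p → f (proj₁ p) , h (proj₂ p)) , (λ p → g (proj₁ p) , i (proj₂ p))
¬-cong : ∀ {A B : Set} → A ⟺ B → (¬ A) ⟺ (¬ B)
¬-cong (f , g) = (λ na b → na (g b)) , (λ nb a → nb (f a))
Σ-cong : ∀ {D : Set} {P Q : D → Set} → (∀ d → P d ⟺ Q d) → Σ D P ⟺ Σ D Q
Σ-cong h = (λ p → proj₁ p , proj₁ (h (proj₁ p)) (proj₂ p)) , (λ p → proj₁ p , proj₂ (h (proj₁ p)) (proj₂ p))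
Π-cong : ∀ {D : Set} {P Q : D → Set} → (∀ d → P d ⟺ Q d) → ((d : D) → P d) ⟺ ((d : D) → Q d)
Π-cong h = (λ f d → proj₁ (h d) (f d)) , (λ f d → proj₂ (h d) (f d))

Finite-mono : ∀ {D : Set} {P Q : D → Set} → (∀ d → Q d → P d) → Finite P → Finite Q
Finite-mono h (xs , f) = xs , λ d q → f d (h d q)

Finite-cong : ∀ {D : Set} {P Q : D → Set} → (∀ d → P d ⟺ Q d) → Finite P ⟺ Finite Q
Finite-cong h = Finite-mono (λ d → proj₂ (h d)) , Finite-mono (λ d → proj₁ (h d))

Finite-∪ : ∀ {D : Set} {P Q R : D → Set} → (∀ d → R d → P d ⊎ Q d) → Finite P → Finite Q → Finite R
Finite-∪ h (xs , f) (ys , g) = xs ++ ys , λ d r → [ (λ p → ∈-++⁺ˡ (f d p)) , (λ q → ∈-++⁺ʳ xs (g d q)) ] (h d r)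

ext-cong : ∀ {D : Set} {n} {g h : Fin n → D} → (∀ i → g i ≡ h i) → ∀ d i → ext g d i ≡ ext h d i
ext-cong e d zero = refl
ext-cong e d (suc i) = e i

Sat-cong : ∀ {k L n} (𝔐 : Model k) {g h : Fin n → D 𝔐} → (∀ i → g i ≡ h i) → (φ : Formula k L n) → Sat 𝔐 g φ ⟺ Sat 𝔐 h φ
Sat-cong 𝔐 e tt = ⟺-refl
Sat-cong 𝔐 e ff = ⟺-refl
Sat-cong 𝔐 e (pos a x) rewrite e x = ⟺-refl
Sat-cong 𝔐 e (neg a x) rewrite e x = ⟺-refl
Sat-cong 𝔐 e (eq x y) rewrite e x | e y = ⟺-refl
Sat-cong 𝔐 e (neq x y) rewrite e x | e y = ⟺-refl
Sat-cong 𝔐 e (φ ∨f ψ) = ⊎-cong (Sat-cong 𝔐 e φ) (Sat-cong 𝔐 e ψ)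
Sat-cong 𝔐 e (φ ∧f ψ) = ×-cong (Sat-cong 𝔐 e φ) (Sat-cong 𝔐 e ψ)
Sat-cong 𝔐 e (ex φ) = Σ-cong λ d → Sat-cong 𝔐 (ext-cong e d) φ
Sat-cong 𝔐 e (all φ) = Π-cong λ d → Sat-cong 𝔐 (ext-cong e d) φ
Sat-cong 𝔐 e (exInf φ) = ¬-cong (Finite-cong λ d → Sat-cong 𝔐 (ext-cong e d) φ)
Sat-cong 𝔐 e (allInf φ) = Finite-cong λ d → ¬-cong (Sat-cong 𝔐 (ext-cong e d) φ)

Sat-closed : ∀ {k L} (𝔐 : Model k) (g : Fin 0 → D 𝔐) (φ : Sentence k L) → Sat 𝔐 g φ ⟺ Sat₀ 𝔐 φ
Sat-closed 𝔐 g φ = Sat-cong 𝔐 (λ ()) φ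

lift : ∀ {n m} → (Fin n → Fin m) → Fin (suc n) → Fin (suc m)
lift ρ zero = zero
lift ρ (suc i) = suc (ρ i)

ext-lift : ∀ {D : Set} {n m} (ρ : Fin n → Fin m) {g : Fin m → D} {h : Fin n → D} →
  (∀ i → h i ≡ g (ρ i)) → ∀ d i → ext h d i ≡ ext g d (lift ρ i)
ext-lift ρ e d zero = refl
ext-lift ρ e d (suc i) = e i

ren : ∀ {k L n m} → (Fin n → Fin m) → Formula k L n → Formula k L m
ren ρ tt = tt
ren ρ ff = ff
ren ρ (pos a x) = pos a (ρ x)
ren ρ (neg a x) = neg a (ρ x)
ren ρ (eq x y) = eq (ρ x) (ρ y)
ren ρ (neq x y) = neq (ρ x) (ρ y)
ren ρ (φ ∨f ψ) = ren ρ φ ∨f ren ρ ψ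
ren ρ (φ ∧f ψ) = ren ρ φ ∧f ren ρ ψ
ren ρ (ex φ) = ex (ren (lift ρ) φ)
ren ρ (all φ) = all (ren (lift ρ) φ)
ren ρ (exInf φ) = exInf (ren (lift ρ) φ)
ren ρ (allInf φ) = allInf (ren (lift ρ) φ)

ren-sat : ∀ {k L n m} (𝔐 : Model k) (ρ : Fin n → Fin m) {g : Fin m → D 𝔐} {h : Fin n → D 𝔐} →
  (∀ i → h i ≡ g (ρ i)) → (φ : Formula k L n) → Sat 𝔐 g (ren ρ φ) ⟺ Sat 𝔐 h φ
ren-sat 𝔐 ρ e tt = ⟺-refl
ren-sat 𝔐 ρ e ff = ⟺-refl
ren-sat 𝔐 ρ e (pos a x) rewrite e x = ⟺-refl
ren-sat 𝔐 ρ e (neg a x) rewrite e x = ⟺-refl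
ren-sat 𝔐 ρ e (eq x y) rewrite e x | e y = ⟺-refl
ren-sat 𝔐 ρ e (neq x y) rewrite e x | e y = ⟺-refl
ren-sat 𝔐 ρ e (φ ∨f ψ) = ⊎-cong (ren-sat 𝔐 ρ e φ) (ren-sat 𝔐 ρ e ψ)
ren-sat 𝔐 ρ e (φ ∧f ψ) = ×-cong (ren-sat 𝔐 ρ e φ) (ren-sat 𝔐 ρ e ψ)
ren-sat 𝔐 ρ e (ex φ) = Σ-cong λ d → ren-sat 𝔐 (lift ρ) (ext-lift ρ e d) φ
ren-sat 𝔐 ρ e (all φ) = Π-cong λ d → ren-sat 𝔐 (lift ρ) (ext-lift ρ e d) φ
ren-sat 𝔐 ρ e (exInf φ) = ¬-cong (Finite-cong λ d → ren-sat 𝔐 (lift ρ) (ext-lift ρ e d) φ)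
ren-sat 𝔐 ρ e (allInf φ) = Finite-cong λ d → ¬-cong (ren-sat 𝔐 (lift ρ) (ext-lift ρ e d) φ)

ren-free : ∀ {k L n m} {B : Subset k} (ρ : Fin n → Fin m) {φ : Formula k L n} → Free B φ → Free B (ren ρ φ)
ren-free ρ tt = tt
ren-free ρ ff = ff
ren-free ρ (pos a x p) = pos a (ρ x) p
ren-free ρ (neg a x p) = neg a (ρ x) p
ren-free ρ (eq x y) = eq (ρ x) (ρ y)
ren-free ρ (neq x y) = neq (ρ x) (ρ y)
ren-free ρ (p ∨f q) = ren-free ρ p ∨f ren-free ρ q
ren-free ρ (p ∧f q) = ren-free ρ p ∧f ren-free ρ q
ren-free ρ (ex p) = ex (ren-free (lift ρ) p)
ren-free ρ (all p) = all (ren-free (lift ρ) p)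
ren-free ρ (exInf p) = exInf (ren-free (lift ρ) p)
ren-free ρ (allInf p) = allInf (ren-free (lift ρ) p)

∼ : ∀ {k L n} → Formula k L n → Formula k L n
∼ tt = ff
∼ ff = tt
∼ (pos a x) = neg a x
∼ (neg a x) = pos a x
∼ (eq x y) = neq x y
∼ (neq x y) = eq x y
∼ (φ ∨f ψ) = ∼ φ ∧f ∼ ψ
∼ (φ ∧f ψ) = ∼ φ ∨f ∼ ψ
∼ (ex φ) = all (∼ φ)
∼ (all φ) = ex (∼ φ)
∼ (exInf φ) = allInf (∼ φ)
∼ (allInf φ) = exInf (∼ φ)

∼-free : ∀ {k L n} {B : Subset k} {φ : Formula k L n} → Free B φ → Free B (∼ φ)
∼-free tt = ff
∼-free ff = tt
∼-free (pos a x p) = neg a x p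
∼-free (neg a x p) = pos a x p
∼-free (eq x y) = neq x y
∼-free (neq x y) = eq x y
∼-free (p ∨f q) = ∼-free p ∧f ∼-free q
∼-free (p ∧f q) = ∼-free p ∨f ∼-free q
∼-free (ex p) = all (∼-free p)
∼-free (all p) = ex (∼-free p)
∼-free (exInf p) = allInf (∼-free p)
∼-free (allInf p) = exInf (∼-free p)

module Classical (em : ExcludedMiddle 0ℓ) where

  dne : {A : Set} → ¬ ¬ A → A
  dne {A} nn with em {A}
  ... | yes a = a
  ... | no na = ⊥-elim (nn na)

  ¬¬-⟺ : {A : Set} → (¬ ¬ A) ⟺ A
  ¬¬-⟺ = dne , λ a na → na a

  ∼-sat : ∀ {k L n} (𝔐 : Model k) (g : Fin n → D 𝔐) (φ : Formula k L n) → Sat 𝔐 g (∼ φ) ⟺ (¬ Sat 𝔐 g φ)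
  ∼-sat 𝔐 g tt = (λ ()) , λ f → f tt
  ∼-sat 𝔐 g ff = (λ _ ()) , λ _ → tt
  ∼-sat 𝔐 g (pos a x) = ⟺-refl
  ∼-sat 𝔐 g (neg a x) = ⟺-sym ¬¬-⟺
  ∼-sat 𝔐 g (eq x y) = ⟺-refl
  ∼-sat 𝔐 g (neq x y) = ⟺-sym ¬¬-⟺
  ∼-sat 𝔐 g (φ ∨f ψ) = ⟺-trans (×-cong (∼-sat 𝔐 g φ) (∼-sat 𝔐 g ψ))
     ((λ p → [ proj₁ p , proj₂ p ]) , λ f → (λ a → f (inj₁ a)) , (λ b → f (inj₂ b)))
  ∼-sat 𝔐 g (φ ∧f ψ) = ⟺-trans (⊎-cong (∼-sat 𝔐 g φ) (∼-sat 𝔐 g ψ))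
     ((λ s p → [ (λ na → na (proj₁ p)) , (λ nb → nb (proj₂ p)) ] s) ,
      λ f → dne λ h → h (inj₁ λ a → h (inj₂ λ b → f (a , b))))
  ∼-sat 𝔐 g (ex φ) = ⟺-trans (Π-cong λ d → ∼-sat 𝔐 (ext g d) φ)
     ((λ f p → f (proj₁ p) (proj₂ p)) , λ f d s → f (d , s))
  ∼-sat 𝔐 g (all φ) = ⟺-trans (Σ-cong λ d → ∼-sat 𝔐 (ext g d) φ)
     ((λ p f → proj₂ p (f (proj₁ p))) , λ h → dne λ k → h λ d → dne λ ns → k (d , ns))
  ∼-sat 𝔐 g (exInf φ) = ⟺-trans (Finite-cong λ d → ⟺-trans (¬-cong (∼-sat 𝔐 (ext g d) φ)) ¬¬-⟺)
     (⟺-sym ¬¬-⟺)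
  ∼-sat 𝔐 g (allInf φ) = ¬-cong (Finite-cong λ d → ∼-sat 𝔐 (ext g d) φ)

⋀ : ∀ {k L n m} → (Fin m → Formula k L n) → Formula k L n
⋀ {m = zero} f = tt
⋀ {m = suc m} f = f zero ∧f ⋀ (λ i → f (suc i))

⋁ : ∀ {k L n m} → (Fin m → Formula k L n) → Formula k L n
⋁ {m = zero} f = ff
⋁ {m = suc m} f = f zero ∨f ⋁ (λ i → f (suc i))

⋀-sat : ∀ {k L n m} (𝔐 : Model k) (g : Fin n → D 𝔐) (f : Fin m → Formula k L n) →
  Sat 𝔐 g (⋀ f) ⟺ (∀ i → Sat 𝔐 g (f i))
⋀-sat {m = zero} 𝔐 g f = (λ _ ()) , λ _ → tt
⋀-sat {m = suc m} 𝔐 g f =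
  (λ p → λ { zero → proj₁ p ; (suc i) → proj₁ (⋀-sat 𝔐 g (λ i → f (suc i))) (proj₂ p) i }) ,
  λ h → h zero , proj₂ (⋀-sat 𝔐 g (λ i → f (suc i))) (λ i → h (suc i))

⋁-sat : ∀ {k L n m} (𝔐 : Model k) (g : Fin n → D 𝔐) (f : Fin m → Formula k L n) →
  Sat 𝔐 g (⋁ f) ⟺ Σ (Fin m) (λ i → Sat 𝔐 g (f i))
⋁-sat {m = zero} 𝔐 g f = (λ ()) , λ { (() , _) }
⋁-sat {m = suc m} 𝔐 g f =
  [ (λ s → zero , s) , (λ s → let r = proj₁ (⋁-sat 𝔐 g (λ i → f (suc i))) s in suc (proj₁ r) , proj₂ r) ] ,
  λ { (zero , s) → inj₁ s ; (suc i , s) → inj₂ (proj₂ (⋁-sat 𝔐 g (λ i → f (suc i))) (i , s)) }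

⋀-free : ∀ {k L n m} {B : Subset k} (f : Fin m → Formula k L n) → (∀ i → Free B (f i)) → Free B (⋀ f)
⋀-free {m = zero} f h = tt
⋀-free {m = suc m} f h = h zero ∧f ⋀-free (λ i → f (suc i)) (λ i → h (suc i))

⋁-free : ∀ {k L n m} {B : Subset k} (f : Fin m → Formula k L n) → (∀ i → Free B (f i)) → Free B (⋁ f)
⋁-free {m = zero} f h = ff
⋁-free {m = suc m} f h = h zero ∨f ⋁-free (λ i → f (suc i)) (λ i → h (suc i))

⋀-SynCont : ∀ {k L n m} {B : Subset k} (f : Fin m → Formula k L n) → (∀ i → SynCont B (f i)) → SynCont B (⋀ f)
⋀-SynCont {m = zero} f h = base tt
⋀-SynCont {m = suc m} f h = h zero ∧c ⋀-SynCont (λ i → f (suc i)) (λ i → h (suc i))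

-- Syntactic continuity implies continuity

Valuation : ℕ → Set → Set₁
Valuation k D = Fin k → D → Set

⇔→⟺ : ∀ {A B : Set} → A ⇔ B → A ⟺ B
⇔→⟺ e = Equivalence.to e , Equivalence.from e

⟺→⇔ : ∀ {A B : Set} → A ⟺ B → A ⇔ B
⟺→⇔ e = mk⇔ (proj₁ e) (proj₂ e)

module _ {k : ℕ} (B : Subset k) {D : Set} where

  Free⇒Sat-cong : ∀ {L n} {φ : Formula k L n} → Free B φ → (V V′ : Valuation k D) →
    (∀ a → a ∉ B → ∀ d → V a d ⟺ V′ a d) → (g : Fin n → D) → Sat (model D V) g φ ⟺ Sat (model D V′) g φ
  Free⇒Sat-cong tt V V′ h g = ⟺-refl
  Free⇒Sat-cong ff V V′ h g = ⟺-refl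
  Free⇒Sat-cong (pos a x p) V V′ h g = h a p (g x)
  Free⇒Sat-cong (neg a x p) V V′ h g = ¬-cong (h a p (g x))
  Free⇒Sat-cong (eq x y) V V′ h g = ⟺-refl
  Free⇒Sat-cong (neq x y) V V′ h g = ⟺-refl
  Free⇒Sat-cong (p ∨f q) V V′ h g = ⊎-cong (Free⇒Sat-cong p V V′ h g) (Free⇒Sat-cong q V V′ h g)
  Free⇒Sat-cong (p ∧f q) V V′ h g = ×-cong (Free⇒Sat-cong p V V′ h g) (Free⇒Sat-cong q V V′ h g)
  Free⇒Sat-cong (ex p) V V′ h g = Σ-cong λ d → Free⇒Sat-cong p V V′ h (ext g d)
  Free⇒Sat-cong (all p) V V′ h g = Π-cong λ d → Free⇒Sat-cong p V V′ h (ext g d)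
  Free⇒Sat-cong (exInf p) V V′ h g = ¬-cong (Finite-cong λ d → Free⇒Sat-cong p V V′ h (ext g d))
  Free⇒Sat-cong (allInf p) V V′ h g = Finite-cong λ d → ¬-cong (Free⇒Sat-cong p V V′ h (ext g d))

  ≤[]-∉ : {U W : Valuation k D} → U ≤[ B ] W → ∀ a → a ∉ B → ∀ d → U a d ⟺ W a d
  ≤[]-∉ le a p d = ⇔→⟺ (proj₂ le a p d)

  overrideB : (Vᴮ V : Valuation k D) → Valuation k D
  overrideB Vᴮ V a = if does (a ∈? B) then Vᴮ a else V a

  module _ (Vᴮ V : Valuation k D) where

    overrideB-∈ : ∀ {a} → a ∈ B → overrideB Vᴮ V a ≡ Vᴮ a
    overrideB-∈ {a} p with a ∈? B
    ... | yes _ = refl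
    ... | no p∉ = ⊥-elim (p∉ p)

    overrideB-∉ : ∀ {a} → a ∉ B → overrideB Vᴮ V a ≡ V a
    overrideB-∉ {a} p with a ∈? B
    ... | yes p∈ = ⊥-elim (p p∈)
    ... | no _ = refl

    overrideB-∈⟺ : ∀ {a} → a ∈ B → ∀ d → overrideB Vᴮ V a d ⟺ Vᴮ a d
    overrideB-∈⟺ {a} p d = subst (λ P → P d ⟺ Vᴮ a d) (sym (overrideB-∈ p)) ⟺-refl

    overrideB-∉⟺ : ∀ {a} → a ∉ B → ∀ d → overrideB Vᴮ V a d ⟺ V a d
    overrideB-∉⟺ {a} p d = subst (λ P → P d ⟺ V a d) (sym (overrideB-∉ p)) ⟺-refl

    ≤-overrideB : ∀ {U} → (∀ b → b ∈ B → ∀ d → U b d → Vᴮ b d) → (∀ a → a ∉ B → ∀ d → U a d ⟺ V a d) →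
      U ≤[ B ] overrideB Vᴮ V
    ≤-overrideB {U} on off =
      (λ b p d u → subst (λ P → P d) (sym (overrideB-∈ p)) (on b p d u)) ,
      λ a p d → ⟺→⇔ (subst (λ P → U a d ⟺ P d) (sym (overrideB-∉ p)) (off a p d))

    overrideB-≤ : (∀ b → b ∈ B → ∀ d → Vᴮ b d → V b d) → overrideB Vᴮ V ≤[ B ] V
    overrideB-≤ on =
      (λ b p d → subst (λ P → P d → V b d) (sym (overrideB-∈ p)) (on b p d)) ,
      (λ a p d → ⟺→⇔ (overrideB-∉⟺ p d))

    overrideB-≤ω : (∀ b → b ∈ B → ∀ d → Vᴮ b d → V b d) → (∀ b → b ∈ B → Finite (Vᴮ b)) →
      overrideB Vᴮ V ≤ω[ B ] V
    overrideB-≤ω on fin = overrideB-≤ on , λ b p → subst Finite (sym (overrideB-∈ p)) (fin b p)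

  emptyOnB : Valuation k D → Valuation k D
  emptyOnB = overrideB (λ _ _ → ⊥)

  emptyOnB-≤ω : (V : Valuation k D) → emptyOnB V ≤ω[ B ] V
  emptyOnB-≤ω V = overrideB-≤ω _ V (λ _ _ _ ()) (λ _ _ → [] , λ _ ())

  unionOnB : Valuation k D → Valuation k D → Valuation k D → Valuation k D
  unionOnB V U₁ U₂ = overrideB (λ a d → U₁ a d ⊎ U₂ a d) V

  unionOnB-≤ω : (V U₁ U₂ : Valuation k D) → U₁ ≤ω[ B ] V → U₂ ≤ω[ B ] V → unionOnB V U₁ U₂ ≤ω[ B ] V
  unionOnB-≤ω V U₁ U₂ ((on₁ , _) , fin₁) ((on₂ , _) , fin₂) =
    overrideB-≤ω _ V (λ b p d → [ on₁ b p d , on₂ b p d ]) (λ b p → Finite-∪ (λ _ u → u) (fin₁ b p) (fin₂ b p))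

  ≤-unionOnBˡ : (V U₁ U₂ : Valuation k D) → U₁ ≤[ B ] V → U₁ ≤[ B ] unionOnB V U₁ U₂
  ≤-unionOnBˡ V U₁ U₂ le = ≤-overrideB _ V (λ _ _ _ → inj₁) (≤[]-∉ le)

  ≤-unionOnBʳ : (V U₁ U₂ : Valuation k D) → U₂ ≤[ B ] V → U₂ ≤[ B ] unionOnB V U₁ U₂
  ≤-unionOnBʳ V U₁ U₂ le = ≤-overrideB _ V (λ _ _ _ → inj₂) (≤[]-∉ le)

  singletonOnB : Valuation k D → Fin k → D → Valuation k D
  singletonOnB V b e = overrideB (λ a d → (a ≡ b) × (d ≡ e)) V

  singletonOnB-≤ω : ∀ {V b e} → V b e → singletonOnB V b e ≤ω[ B ] V
  singletonOnB-≤ω {V} v = overrideB-≤ω _ V (λ { _ _ _ (refl , refl) → v }) (λ _ _ → (_ ∷ []) , λ { _ (refl , refl) → here refl })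

  singletonOnB-∋ : ∀ V b e → b ∈ B → singletonOnB V b e b e
  singletonOnB-∋ V b e p = subst (λ P → P e) (sym (overrideB-∈ (λ a d → (a ≡ b) × (d ≡ e)) V p)) (refl , refl)

concatFin : ∀ {X : Set} (m : ℕ) → (Fin m → List X) → List X
concatFin zero f = []
concatFin (suc m) f = f zero ++ concatFin m (λ i → f (suc i))

concatFin-∈ : ∀ {X : Set} (m : ℕ) (f : Fin m → List X) i {x} → x ∈ₗ f i → x ∈ₗ concatFin m f
concatFin-∈ (suc m) f zero x∈ = ∈-++⁺ˡ x∈
concatFin-∈ (suc m) f (suc i) x∈ = ∈-++⁺ʳ (f zero) (concatFin-∈ m (λ i → f (suc i)) i x∈)

≤ω-B-support-finite : ∀ {k} {D : Set} {B : Subset k} {U V : Valuation k D} → U ≤ω[ B ] V →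
  Finite (λ e → Σ (Fin k) λ b → b ∈ B × U b e)
≤ω-B-support-finite {k} {D} {B} {U} (_ , fin) = concatFin k (λ b → support b (b ∈? B)) , λ { e (b , p , u) → concatFin-∈ k _ b (∈support b p e u (b ∈? B)) }
  where
    support : ∀ b → Dec (b ∈ B) → List D
    support b (yes p) = proj₁ (fin b p)
    support b (no _) = []
    ∈support : ∀ b → b ∈ B → ∀ e → U b e → ∀ b∈? → e ∈ₗ support b b∈?
    ∈support b p e u (yes p′) = proj₂ (fin b p′) e u
    ∈support b p e u (no p∉) = ⊥-elim (p∉ p)

module _ (em : ExcludedMiddle 0ℓ) {k : ℕ} (B : Subset k) where
  open Classical em

  SynCont⇒Continuous : ∀ {L n} {φ : Formula k L n} → SynCont B φ → Continuous B φ
  SynCont⇒Continuous (base p) = (λ D V V′ g s le → proj₁ (Free⇒Sat-cong B p V V′ (≤[]-∉ B le) g) s) ,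
     λ D V g s → emptyOnB B V , emptyOnB-≤ω B V , proj₂ (Free⇒Sat-cong B p (emptyOnB B V) V (≤[]-∉ B (proj₁ (emptyOnB-≤ω B V))) g) s
  SynCont⇒Continuous (pos b x p) =
    (λ D V V′ g s le → proj₁ le b p (g x) s) ,
    λ D V g s → singletonOnB B V b (g x) , singletonOnB-≤ω B s , singletonOnB-∋ B V b (g x) p
  SynCont⇒Continuous {φ = φ₁ ∧f φ₂} (c₁ ∧c c₂) with SynCont⇒Continuous c₁ | SynCont⇒Continuous c₂
  ... | (m₁ , k₁) | (m₂ , k₂) =
    (λ D V V′ g s le → m₁ D V V′ g (proj₁ s) le , m₂ D V V′ g (proj₂ s) le) ,
    λ D V g s → let (U₁ , le₁ , s₁) = k₁ D V g (proj₁ s)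
                    (U₂ , le₂ , s₂) = k₂ D V g (proj₂ s)
                in unionOnB B V U₁ U₂ , unionOnB-≤ω B V U₁ U₂ le₁ le₂ ,
                   (m₁ D U₁ (unionOnB B V U₁ U₂) g s₁ (≤-unionOnBˡ B V U₁ U₂ (proj₁ le₁)) ,
                    m₂ D U₂ (unionOnB B V U₁ U₂) g s₂ (≤-unionOnBʳ B V U₁ U₂ (proj₁ le₂)))
  SynCont⇒Continuous (c₁ ∨c c₂) with SynCont⇒Continuous c₁ | SynCont⇒Continuous c₂
  ... | (m₁ , k₁) | (m₂ , k₂) =
    (λ D V V′ g s le → [ (λ x → inj₁ (m₁ D V V′ g x le)) , (λ x → inj₂ (m₂ D V V′ g x le)) ] s) ,
    λ D V g → [ (λ x → let (U , le , s) = k₁ D V g x in U , le , inj₁ s) ,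
                (λ x → let (U , le , s) = k₂ D V g x in U , le , inj₂ s) ]
  SynCont⇒Continuous (ex c) with SynCont⇒Continuous c
  ... | (m , k′) = (λ D V V′ g s le → proj₁ s , m D V V′ (ext g (proj₁ s)) (proj₂ s) le) ,
    λ D V g s → let (U , le , s′) = k′ D V (ext g (proj₁ s)) (proj₂ s) in U , le , (proj₁ s , s′)
  SynCont⇒Continuous {n = n} (W {φ = φ} {ψ = ψ} c p) with SynCont⇒Continuous c
  ... | (m , k′) = mono , cont
    where
      mono : Monotone B (Wq φ ψ)
      mono D V V′ g (s₁ , s₂) le =
        (λ d → [ (λ x → inj₁ (m D V V′ (ext g d) x le)) ,
                 (λ x → inj₂ (proj₁ (Free⇒Sat-cong B p V V′ (≤[]-∉ B le) (ext g d)) x)) ] (s₁ d)) ,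
        proj₁ (Finite-cong λ d → ¬-cong (Free⇒Sat-cong B p V V′ (≤[]-∉ B le) (ext g d))) s₂
      cont : ∀ (D : Set) (V : Fin k → D → Set) g → Sat (model D V) g (Wq φ ψ) →
        Σ (Fin k → D → Set) λ U → U ≤ω[ B ] V × Sat (model D U) g (Wq φ ψ)
      cont D V g (s₁ , (ys , fin)) = U , le , sat
        where
          aux : (zs : List D) → Σ (Fin k → D → Set) λ U → U ≤ω[ B ] V ×
                 (∀ y → y ∈ₗ zs → Sat (model D V) (ext g y) ψ ⊎ Sat (model D U) (ext g y) φ)
          aux [] = emptyOnB B V , emptyOnB-≤ω B V , λ _ ()
          aux (z ∷ zs) with aux zs | s₁ z
          ... | (U₀ , le₀ , h₀) | inj₂ ψz = U₀ , le₀ , λ { y (here refl) → inj₁ ψz ; y (there q) → h₀ y q }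
          ... | (U₀ , le₀ , h₀) | inj₁ φz with k′ D V (ext g z) φz
          ... | (U₁ , le₁ , sz) = unionOnB B V U₀ U₁ , unionOnB-≤ω B V U₀ U₁ le₀ le₁ ,
                λ { y (here refl) → inj₂ (m D U₁ _ (ext g y) sz (≤-unionOnBʳ B V U₀ U₁ (proj₁ le₁)))
                  ; y (there q) → [ inj₁ , (λ x → inj₂ (m D U₀ _ (ext g y) x (≤-unionOnBˡ B V U₀ U₁ (proj₁ le₀)))) ] (h₀ y q) }
          U = proj₁ (aux ys)
          le = proj₁ (proj₂ (aux ys))
          h = proj₂ (proj₂ (aux ys))
          tr : ∀ d → Sat (model D V) (ext g d) ψ ⟺ Sat (model D U) (ext g d) ψ
          tr d = Free⇒Sat-cong B p V U (λ a q e → ⟺-sym (≤[]-∉ B (proj₁ le) a q e)) (ext g d)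
          sat : Sat (model D U) g (Wq φ ψ)
          sat = (λ d → f d em) , proj₁ (Finite-cong λ d → ¬-cong (tr d)) (ys , fin)
            where
              f : ∀ d → Dec (Sat (model D V) (ext g d) ψ) → Sat (model D U) (ext g d) φ ⊎ Sat (model D U) (ext g d) ψ
              f d (yes q) = inj₂ (proj₁ (tr d) q)
              f d (no q) = [ (λ x → inj₂ (proj₁ (tr d) x)) , inj₁ ] (h d (fin d q))

  Continuous-resp-≡ₛ : ∀ {L} {φ ψ : Sentence k L} → φ ≡ₛ ψ → Continuous B ψ → Continuous B φ
  Continuous-resp-≡ₛ {φ = φ} {ψ} e (m , c) =
    (λ D V V′ g s le → back D V′ g (m D V V′ g (fwd D V g s) le)) ,
    λ D V g s → let (U , le , s′) = c D V g (fwd D V g s) in U , le , back D U g s′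
    where
      fwd : ∀ D V g → Sat (model D V) g φ → Sat (model D V) g ψ
      fwd D V g s = proj₂ (Sat-closed (model D V) g ψ) (Equivalence.to (e (model D V)) (proj₁ (Sat-closed (model D V) g φ) s))
      back : ∀ D V g → Sat (model D V) g ψ → Sat (model D V) g φ
      back D V g s = proj₂ (Sat-closed (model D V) g φ) (Equivalence.from (e (model D V)) (proj₁ (Sat-closed (model D V) g ψ) s))

-- Atomic types

does≡true⟺ : ∀ {P : Set} (d : Dec P) → (does d ≡ true) ⟺ P
does≡true⟺ (yes p) = (λ _ → p) , λ _ → refl
does≡true⟺ (no np) = (λ ()) , λ p → ⊥-elim (np p)

true≢false : true ≡ false → ⊥
true≢false ()

allVecs : (k : ℕ) → List (Vec Bool k)
allVecs zero = [] ∷ []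
allVecs (suc k) = map (true ∷_) (allVecs k) ++ map (false ∷_) (allVecs k)

allVecs-complete : ∀ {k} (v : Vec Bool k) → v ∈ₗ allVecs k
allVecs-complete [] = here refl
allVecs-complete {suc k} (true ∷ v) = ∈-++⁺ˡ (∈-map⁺ (true ∷_) (allVecs-complete v))
allVecs-complete {suc k} (false ∷ v) = ∈-++⁺ʳ (map (true ∷_) (allVecs k)) (∈-map⁺ (false ∷_) (allVecs-complete v))

Ty : ℕ → Set
Ty k = Vec Bool k

HasTy : ∀ {k} (𝔐 : Model k) → Ty k → D 𝔐 → Set
HasTy 𝔐 τ d = ∀ a → V 𝔐 a d ⟺ (lookup τ a ≡ true)

lookup-ext : ∀ {k} (τ σ : Vec Bool k) → (∀ a → lookup τ a ≡ lookup σ a) → τ ≡ σ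
lookup-ext [] [] h = refl
lookup-ext (x ∷ τ) (y ∷ σ) h = cong₂ _∷_ (h zero) (lookup-ext τ σ (λ a → h (suc a)))

≡true-ext : (x y : Bool) → (x ≡ true → y ≡ true) → (y ≡ true → x ≡ true) → x ≡ y
≡true-ext true true f g = refl
≡true-ext true false f g = sym (f refl)
≡true-ext false true f g = g refl
≡true-ext false false f g = refl

hasTy-unique : ∀ {k} (𝔐 : Model k) τ σ d → HasTy 𝔐 τ d → HasTy 𝔐 σ d → τ ≡ σ
hasTy-unique 𝔐 τ σ d h₁ h₂ = lookup-ext τ σ λ a → ≡true-ext _ _ (λ l → proj₁ (h₂ a) (proj₂ (h₁ a) l)) (λ l → proj₁ (h₁ a) (proj₂ (h₂ a) l))

module TypeOf (em : ExcludedMiddle 0ℓ) where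

  typeOf : ∀ {k} (𝔐 : Model k) → D 𝔐 → Ty k
  typeOf 𝔐 d = tabulate (λ a → does (em {V 𝔐 a d}))

  typeOf-HasTy : ∀ {k} (𝔐 : Model k) d → HasTy 𝔐 (typeOf 𝔐 d) d
  typeOf-HasTy 𝔐 d a rewrite lookup∘tabulate (λ a → does (em {V 𝔐 a d})) a = ⟺-sym (does≡true⟺ em)

module TypeFormulas {k : ℕ} (B : Subset k) where

  literal : ∀ {L n} → Ty k → Fin k → Fin n → Formula k L n
  literal τ a x = if lookup τ a then pos a x else neg a x

  colour : ∀ {L n} → Ty k → Fin n → Formula k L n
  colour τ x = ⋀ (λ a → if does (a ∈? B) then tt else literal τ a x)

  bPart : ∀ {L n} → Ty k → Fin n → Formula k L n
  bPart τ x = ⋀ (λ a → if does (a ∈? B) then (if lookup τ a then pos a x else tt) else tt)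

  HasColour : {D : Set} → (Fin k → D → Set) → Ty k → D → Set
  HasColour V τ d = ∀ a → a ∉ B → V a d ⟺ (lookup τ a ≡ true)

  HasBPart : {D : Set} → (Fin k → D → Set) → Ty k → D → Set
  HasBPart V τ d = ∀ a → a ∈ B → lookup τ a ≡ true → V a d

  literal-sat : ∀ {L n} (𝔐 : Model k) (g : Fin n → D 𝔐) τ a x →
    Sat 𝔐 g (literal {L} τ a x) ⟺ (V 𝔐 a (g x) ⟺ (lookup τ a ≡ true))
  literal-sat 𝔐 g τ a x with lookup τ a
  ... | true = (λ v → (λ _ → refl) , λ _ → v) , λ h → proj₂ h refl
  ... | false = (λ nv → (λ v → ⊥-elim (nv v)) , λ ()) , λ h v → true≢false (sym (proj₁ h v))

  colour-sat : ∀ {L n} (𝔐 : Model k) (g : Fin n → D 𝔐) τ x →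
    Sat 𝔐 g (colour {L} τ x) ⟺ HasColour (V 𝔐) τ (g x)
  colour-sat 𝔐 g τ x = ⟺-trans (⋀-sat 𝔐 g _) ((λ h a p → f₁ a p (h a)) , λ h a → f₂ a (h a))
    where
      f₁ : ∀ a → a ∉ B → Sat 𝔐 g (if does (a ∈? B) then tt else literal τ a x) → V 𝔐 a (g x) ⟺ (lookup τ a ≡ true)
      f₁ a p with a ∈? B
      ... | yes q = ⊥-elim (p q)
      ... | no _ = proj₁ (literal-sat 𝔐 g τ a x)
      f₂ : ∀ a → (a ∉ B → V 𝔐 a (g x) ⟺ (lookup τ a ≡ true)) → Sat 𝔐 g (if does (a ∈? B) then tt else literal τ a x)
      f₂ a h with a ∈? B
      ... | yes _ = tt
      ... | no q = proj₂ (literal-sat 𝔐 g τ a x) (h q)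

  bPart-sat : ∀ {L n} (𝔐 : Model k) (g : Fin n → D 𝔐) τ x →
    Sat 𝔐 g (bPart {L} τ x) ⟺ HasBPart (V 𝔐) τ (g x)
  bPart-sat 𝔐 g τ x = ⟺-trans (⋀-sat 𝔐 g _) ((λ h a p → f₁ a p (h a)) , λ h a → f₂ a (h a))
    where
      f₁ : ∀ a → a ∈ B → Sat 𝔐 g (if does (a ∈? B) then (if lookup τ a then pos a x else tt) else tt) → lookup τ a ≡ true → V 𝔐 a (g x)
      f₁ a p with a ∈? B
      ... | no q = ⊥-elim (q p)
      ... | yes _ with lookup τ a
      ...   | true = λ v _ → v
      ...   | false = λ _ ()
      f₂ : ∀ a → (a ∈ B → lookup τ a ≡ true → V 𝔐 a (g x)) → Sat 𝔐 g (if does (a ∈? B) then (if lookup τ a then pos a x else tt) else tt)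
      f₂ a h with a ∈? B
      ... | no _ = tt
      ... | yes q with lookup τ a
      ...   | true = h q refl
      ...   | false = tt

  literal-free : ∀ {L n} τ a (x : Fin n) → a ∉ B → Free B (literal {L} τ a x)
  literal-free τ a x p with lookup τ a
  ... | true = pos a x p
  ... | false = neg a x p

  colour-free : ∀ {L n} τ (x : Fin n) → Free B (colour {L} τ x)
  colour-free τ x = ⋀-free _ f
    where
      f : ∀ a → Free B (if does (a ∈? B) then tt else literal τ a x)
      f a with a ∈? B
      ... | yes _ = tt
      ... | no p = literal-free τ a x p

  bPart-SynCont : ∀ {L n} τ (x : Fin n) → SynCont B (bPart {L} τ x)
  bPart-SynCont τ x = ⋀-SynCont _ f
    where
      f : ∀ a → SynCont B (if does (a ∈? B) then (if lookup τ a then pos a x else tt) else tt)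
      f a with a ∈? B
      ... | no _ = base tt
      ... | yes p with lookup τ a
      ...   | true = pos a x p
      ...   | false = base tt

  clearB : Ty k → Ty k
  clearB τ = tabulate (λ a → if does (a ∈? B) then false else lookup τ a)

  clearB-off : ∀ τ a → a ∉ B → lookup (clearB τ) a ≡ lookup τ a
  clearB-off τ a p rewrite lookup∘tabulate (λ a → if does (a ∈? B) then false else lookup τ a) a with a ∈? B
  ... | yes q = ⊥-elim (p q)
  ... | no _ = refl

  clearB-on : ∀ τ a → a ∈ B → lookup (clearB τ) a ≡ false
  clearB-on τ a p rewrite lookup∘tabulate (λ a → if does (a ∈? B) then false else lookup τ a) a with a ∈? B
  ... | yes _ = refl
  ... | no q = ⊥-elim (q p)

-- The translation for M

⋁ₗ : ∀ {k L n} {A : Set} → (A → Formula k L n) → List A → Formula k L n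
⋁ₗ f [] = ff
⋁ₗ f (x ∷ xs) = f x ∨f ⋁ₗ f xs

⋁ₗ-sat : ∀ {k L n} {A : Set} (𝔐 : Model k) (g : Fin n → D 𝔐) (f : A → Formula k L n) (xs : List A) →
  Sat 𝔐 g (⋁ₗ f xs) ⟺ Σ A (λ x → x ∈ₗ xs × Sat 𝔐 g (f x))
⋁ₗ-sat 𝔐 g f [] = (λ ()) , λ { (_ , () , _) }
⋁ₗ-sat 𝔐 g f (x ∷ xs) =
  [ (λ s → x , here refl , s) , (λ s → let (y , m , s′) = proj₁ (⋁ₗ-sat 𝔐 g f xs) s in y , there m , s′) ] ,
  λ { (y , here refl , s) → inj₁ s ; (y , there m , s) → inj₂ (proj₂ (⋁ₗ-sat 𝔐 g f xs) (y , m , s)) }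

⋁ₗ-SynCont : ∀ {k L n} {B : Subset k} {A : Set} (f : A → Formula k L n) (xs : List A) → (∀ x → SynCont B (f x)) → SynCont B (⋁ₗ f xs)
⋁ₗ-SynCont f [] h = base ff
⋁ₗ-SynCont f (x ∷ xs) h = h x ∨c ⋁ₗ-SynCont f xs h

sublists : {A : Set} → List A → List (List A)
sublists [] = [] ∷ []
sublists (x ∷ xs) = map (x ∷_) (sublists xs) ++ sublists xs

filter∈sublists : {A : Set} {P : A → Set} (P? : Decidable P) (xs : List A) → filter P? xs ∈ₗ sublists xs
filter∈sublists P? [] = here refl
filter∈sublists P? (x ∷ xs) with does (P? x)
... | true = ∈-++⁺ˡ (∈-map⁺ (x ∷_) (filter∈sublists P? xs))
... | false = ∈-++⁺ʳ (map (x ∷_) (sublists xs)) (filter∈sublists P? xs)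

∈-concatMap : ∀ {A X : Set} (f : A → List X) (as : List A) {a x} → a ∈ₗ as → x ∈ₗ f a → x ∈ₗ concatMap f as
∈-concatMap f (b ∷ as) (here refl) x∈ = ∈-++⁺ˡ x∈
∈-concatMap f (b ∷ as) (there m) x∈ = ∈-++⁺ʳ (f b) (∈-concatMap f as m x∈)

module _ {k : ℕ} (𝔐₁ 𝔐₂ : Model k) (R : D 𝔐₁ → D 𝔐₂ → Set)
         (R-atoms : ∀ d₁ d₂ → R d₁ d₂ → ∀ a → V 𝔐₁ a d₁ ⟺ V 𝔐₂ a d₂)
         (R-total : ∀ d₁ → Σ (D 𝔐₂) (R d₁)) (R-onto : ∀ d₂ → Σ (D 𝔐₁) λ d₁ → R d₁ d₂) where

  ext-related : ∀ {n} {g₁ : Fin n → D 𝔐₁} {g₂ : Fin n → D 𝔐₂} → (∀ i → R (g₁ i) (g₂ i)) →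
    ∀ {d₁ d₂} → R d₁ d₂ → ∀ i → R (ext g₁ d₁ i) (ext g₂ d₂ i)
  ext-related r q zero = q
  ext-related r q (suc i) = r i

  relation-preserves-Sat : ∀ {n} (g₁ : Fin n → D 𝔐₁) (g₂ : Fin n → D 𝔐₂) → (∀ i → R (g₁ i) (g₂ i)) →
    (φ : Formula k M n) → Sat 𝔐₁ g₁ φ ⟺ Sat 𝔐₂ g₂ φ
  relation-preserves-Sat g₁ g₂ r tt = ⟺-refl
  relation-preserves-Sat g₁ g₂ r ff = ⟺-refl
  relation-preserves-Sat g₁ g₂ r (pos a x) = R-atoms _ _ (r x) a
  relation-preserves-Sat g₁ g₂ r (neg a x) = ¬-cong (R-atoms _ _ (r x) a)
  relation-preserves-Sat g₁ g₂ r (φ ∨f ψ) = ⊎-cong (relation-preserves-Sat g₁ g₂ r φ) (relation-preserves-Sat g₁ g₂ r ψ)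
  relation-preserves-Sat g₁ g₂ r (φ ∧f ψ) = ×-cong (relation-preserves-Sat g₁ g₂ r φ) (relation-preserves-Sat g₁ g₂ r ψ)
  relation-preserves-Sat g₁ g₂ r (ex φ) =
    (λ { (d₁ , s) → let (d₂ , q) = R-total d₁ in d₂ , proj₁ (relation-preserves-Sat _ _ (ext-related r q) φ) s }) ,
    (λ { (d₂ , s) → let (d₁ , q) = R-onto d₂ in d₁ , proj₂ (relation-preserves-Sat _ _ (ext-related r q) φ) s })
  relation-preserves-Sat g₁ g₂ r (all φ) =
    (λ f d₂ → let (d₁ , q) = R-onto d₂ in proj₁ (relation-preserves-Sat _ _ (ext-related r q) φ) (f d₁)) ,
    (λ f d₁ → let (d₂ , q) = R-total d₁ in proj₂ (relation-preserves-Sat _ _ (ext-related r q) φ) (f d₂))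

  relation-preserves-Sat₀ : (φ : Sentence k M) → Sat₀ 𝔐₁ φ → Sat₀ 𝔐₂ φ
  relation-preserves-Sat₀ φ = proj₁ (relation-preserves-Sat _ _ (λ ()) φ)

copies : ∀ {k} → Model k → Model k
copies 𝔐 = model (D 𝔐 × ℕ) (λ a p → V 𝔐 a (proj₁ p))

copies-Sat₀ : ∀ {k} (𝔐 : Model k) (φ : Sentence k M) → Sat₀ 𝔐 φ ⟺ Sat₀ (copies 𝔐) φ
copies-Sat₀ 𝔐 φ =
  relation-preserves-Sat₀ 𝔐 (copies 𝔐) (λ d p → proj₁ p ≡ d) (λ { _ _ refl a → ⟺-refl })
    (λ d → (d , 0) , refl) (λ p → proj₁ p , refl) φ ,
  relation-preserves-Sat₀ (copies 𝔐) 𝔐 (λ p d → proj₁ p ≡ d) (λ { _ _ refl a → ⟺-refl })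
    (λ p → proj₁ p , refl) (λ d → (d , 0) , refl) φ

module ProductModel {k : ℕ} (B : Subset k) where
  open TypeFormulas B

  Monotone-along-relation : (φ : Sentence k M) → Monotone B φ → (𝔐₁ 𝔐₂ : Model k) (R : D 𝔐₁ → D 𝔐₂ → Set) →
    (∀ d₁ d₂ → R d₁ d₂ → ∀ a → a ∉ B → V 𝔐₁ a d₁ ⟺ V 𝔐₂ a d₂) →
    (∀ d₁ d₂ → R d₁ d₂ → ∀ a → a ∈ B → V 𝔐₁ a d₁ → V 𝔐₂ a d₂) →
    (∀ d₁ → Σ (D 𝔐₂) (R d₁)) → (∀ d₂ → Σ (D 𝔐₁) λ d₁ → R d₁ d₂) →
    Sat₀ 𝔐₁ φ → Sat₀ 𝔐₂ φ
  Monotone-along-relation φ mon 𝔐₁ 𝔐₂ R off′ on to su s =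
    relation-preserves-Sat₀ P₂ 𝔐₂ (λ p d → proj₂ (proj₁ p) ≡ d) (λ { p _ refl a → ⟺-refl })
      (λ p → proj₂ (proj₁ p) , refl) (λ d₂ → ((proj₁ (su d₂) , d₂) , proj₂ (su d₂)) , refl) φ
      (mon PD V₁′ V₂′ _ s₁ ((λ b p d x → on _ _ (proj₂ d) b p x) , λ a p d → ⟺→⇔ (off′ _ _ (proj₂ d) a p)))
    where
      PD : Set
      PD = Σ (D 𝔐₁ × D 𝔐₂) λ p → R (proj₁ p) (proj₂ p)
      V₁′ : Fin k → PD → Set
      V₁′ a p = V 𝔐₁ a (proj₁ (proj₁ p))
      V₂′ : Fin k → PD → Set
      V₂′ a p = V 𝔐₂ a (proj₂ (proj₁ p))
      P₁ P₂ : Model k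
      P₁ = model PD V₁′
      P₂ = model PD V₂′
      s₁ : Sat₀ P₁ φ
      s₁ = relation-preserves-Sat₀ 𝔐₁ P₁ (λ d p → d ≡ proj₁ (proj₁ p)) (λ { _ p refl a → ⟺-refl })
             (λ d₁ → ((d₁ , proj₁ (to d₁)) , proj₂ (to d₁)) , refl) (λ p → proj₁ (proj₁ p) , refl) φ s

  module Product (S′ : List (Ty k)) where
    N : ℕ
    N = length S′
    σ : Fin N → Ty k
    σ = lookupₗ S′

    productTranslation : ∀ {n} → (Fin n → Fin N) → Formula k M n → Formula k M n
    productTranslation t tt = tt
    productTranslation t ff = ff
    productTranslation t (pos a x) = if does (a ∈? B) then (if lookup (σ (t x)) a then colour (σ (t x)) x else ff) else pos a x
    productTranslation t (neg a x) = if does (a ∈? B) then (if lookup (σ (t x)) a then ∼ (colour (σ (t x)) x) else tt) else neg a x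
    productTranslation t (φ ∨f ψ) = productTranslation t φ ∨f productTranslation t ψ
    productTranslation t (φ ∧f ψ) = productTranslation t φ ∧f productTranslation t ψ
    productTranslation t (ex φ) = ⋁ (λ s → ex (productTranslation (ext t s) φ))
    productTranslation t (all φ) = ⋀ (λ s → all (productTranslation (ext t s) φ))

    productTranslation-free : ∀ {n} (t : Fin n → Fin N) (φ : Formula k M n) → Free B (productTranslation t φ)
    productTranslation-free t tt = tt
    productTranslation-free t ff = ff
    productTranslation-free t (pos a x) with a ∈? B
    ... | no p = pos a x p
    ... | yes _ with lookup (σ (t x)) a
    ...   | true = colour-free (σ (t x)) x
    ...   | false = ff
    productTranslation-free t (neg a x) with a ∈? B
    ... | no p = neg a x p
    ... | yes _ with lookup (σ (t x)) a
    ...   | true = ∼-free (colour-free (σ (t x)) x)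
    ...   | false = tt
    productTranslation-free t (φ ∨f ψ) = productTranslation-free t φ ∨f productTranslation-free t ψ
    productTranslation-free t (φ ∧f ψ) = productTranslation-free t φ ∧f productTranslation-free t ψ
    productTranslation-free t (ex φ) = ⋁-free _ λ s → ex (productTranslation-free (ext t s) φ)
    productTranslation-free t (all φ) = ⋀-free _ λ s → all (productTranslation-free (ext t s) φ)

    productBPart : {D : Set} → Valuation k D → Valuation k (D × Fin N)
    productBPart V a (d , s) = (lookup (σ s) a ≡ true) × HasColour V (σ s) d

    productValuation : {D : Set} → Valuation k D → Valuation k (D × Fin N)
    productValuation V = overrideB B (productBPart V) (λ a p → V a (proj₁ p))

    module Semantics (em : ExcludedMiddle 0ℓ) where
      open Classical em
      productTranslation-sat : ∀ {n} (D : Set) (V : Fin k → D → Set) (g : Fin n → D) (t : Fin n → Fin N) (φ : Formula k M n) →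
        Sat (model D V) g (productTranslation t φ) ⟺ Sat (model (D × Fin N) (productValuation V)) (λ i → g i , t i) φ
      productTranslation-sat D V g t tt = ⟺-refl
      productTranslation-sat D V g t ff = ⟺-refl
      productTranslation-sat D V g t (pos a x) with a ∈? B
      ... | no _ = ⟺-refl
      ... | yes _ with lookup (σ (t x)) a
      ...   | true = ⟺-trans (colour-sat (model D V) g (σ (t x)) x) ((λ c → refl , c) , proj₂)
      ...   | false = (λ ()) , λ { (() , _) }
      productTranslation-sat D V g t (neg a x) with a ∈? B
      ... | no _ = ⟺-refl
      ... | yes _ with lookup (σ (t x)) a
      ...   | true = ⟺-trans (∼-sat (model D V) g (colour (σ (t x)) x))
                      (¬-cong (⟺-trans (colour-sat (model D V) g (σ (t x)) x) ((λ c → refl , c) , proj₂)))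
      ...   | false = (λ _ → λ { (() , _) }) , λ _ → tt
      productTranslation-sat D V g t (φ ∨f ψ) = ⊎-cong (productTranslation-sat D V g t φ) (productTranslation-sat D V g t ψ)
      productTranslation-sat D V g t (φ ∧f ψ) = ×-cong (productTranslation-sat D V g t φ) (productTranslation-sat D V g t ψ)
      productTranslation-sat D V g t (ex φ) = ⟺-trans (⋁-sat (model D V) g _)
        ((λ { (s , d , x) → (d , s) , proj₁ (ext-sat d s) x }) ,
         λ { ((d , s) , x) → s , d , proj₂ (ext-sat d s) x })
        where
          ext-sat : ∀ d s → Sat (model D V) (ext g d) (productTranslation (ext t s) φ) ⟺
                          Sat (model (D × Fin N) (productValuation V)) (ext (λ i → g i , t i) (d , s)) φ
          ext-sat d s = ⟺-trans (productTranslation-sat D V (ext g d) (ext t s) φ)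
                       (Sat-cong (model (D × Fin N) (productValuation V)) (λ { zero → refl ; (suc i) → refl }) φ)
      productTranslation-sat D V g t (all φ) = ⟺-trans (⋀-sat (model D V) g _)
        ((λ f p → proj₁ (ext-sat (proj₁ p) (proj₂ p)) (f (proj₂ p) (proj₁ p))) ,
         λ f s d → proj₂ (ext-sat d s) (f (d , s)))
        where
          ext-sat : ∀ d s → Sat (model D V) (ext g d) (productTranslation (ext t s) φ) ⟺
                          Sat (model (D × Fin N) (productValuation V)) (ext (λ i → g i , t i) (d , s)) φ
          ext-sat d s = ⟺-trans (productTranslation-sat D V (ext g d) (ext t s) φ)
                       (Sat-cong (model (D × Fin N) (productValuation V)) (λ { zero → refl ; (suc i) → refl }) φ)

module TranslationM {k : ℕ} (B : Subset k) where
  open TypeFormulas B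
  open ProductModel B

  -- The cleared copies give every point a partner without B-atoms: in the product model it
  -- lies below V, and it is matched by a fresh copy outside the finite B-support of U.
  withCleared : List (Ty k) → List (Ty k)
  withCleared S = S ++ map clearB S

  disjunctM : List (Ty k) → Sentence k M → Sentence k M
  disjunctM S φ = (⋀ (λ s → ex (colour (σ s) zero ∧f bPart (σ s) zero)) ∧f all (⋁ (λ s → colour (σ s) zero))) ∧f productTranslation (λ ()) φ
    where open Product (withCleared S)

  tM : Sentence k M → Sentence k M
  tM φ = ⋁ₗ (λ S → disjunctM S φ) (sublists (allVecs k))

  tM-SynCont : (φ : Sentence k M) → SynCont B (tM φ)
  tM-SynCont φ = ⋁ₗ-SynCont _ _ λ S → let open Product (withCleared S) in
     (⋀-SynCont _ (λ s → ex (base (colour-free (σ s) zero) ∧c bPart-SynCont (σ s) zero)) ∧c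
      base (all (⋁-free _ λ s → colour-free (σ s) zero))) ∧c base (productTranslation-free (λ ()) φ)

  module Facts (S : List (Ty k)) where
    open Product (withCleared S)

    source : (s : Fin N) → Σ (Ty k) λ τ → τ ∈ₗ S × ((σ s ≡ τ) ⊎ (σ s ≡ clearB τ))
    source s with ∈-++⁻ S (∈-lookup {xs = withCleared S} s)
    ... | inj₁ m = σ s , m , inj₁ refl
    ... | inj₂ m with ∈-map⁻ clearB m
    ...   | τ , m′ , e = τ , m′ , inj₂ e

    index-of : ∀ {τ} → τ ∈ₗ withCleared S → Σ (Fin N) λ s → τ ≡ σ s
    index-of m = index m , lookup-index m

    index-of-S : ∀ {τ} → τ ∈ₗ S → Σ (Fin N) λ s → τ ≡ σ s
    index-of-S m = index-of (∈-++⁺ˡ m)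

    index-of-cleared : ∀ {τ} → τ ∈ₗ S → Σ (Fin N) λ s → clearB τ ≡ σ s
    index-of-cleared m = index-of (∈-++⁺ʳ S (∈-map⁺ clearB m))

    productValuation-∉ : ∀ {D : Set} (V : Fin k → D → Set) a d s → a ∉ B → productValuation V a (d , s) ⟺ V a d
    productValuation-∉ V a d s p = overrideB-∉⟺ B (productBPart V) (λ a p → V a (proj₁ p)) p (d , s)

    productValuation-∈ : ∀ {D : Set} (V : Fin k → D → Set) a d s → a ∈ B → productValuation V a (d , s) ⟺ ((lookup (σ s) a ≡ true) × HasColour V (σ s) d)
    productValuation-∈ V a d s p = overrideB-∈⟺ B (productBPart V) (λ a p → V a (proj₁ p)) p (d , s)

  module DisjunctM⇒φ (em : ExcludedMiddle 0ℓ) (S : List (Ty k)) (φ : Sentence k M) (mon : Monotone B φ)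
              (D : Set) (V : Fin k → D → Set) (sat : Sat₀ (model D V) (disjunctM S φ)) where
    open Product (withCleared S)
    open Semantics em
    open Facts S

    witness : ∀ s → Σ D λ w → HasColour V (σ s) w × HasBPart V (σ s) w
    witness s = let (w , c , p) = proj₁ (⋀-sat (model D V) _ _) (proj₁ (proj₁ sat)) s
            in w , proj₁ (colour-sat (model D V) _ (σ s) zero) c , proj₁ (bPart-sat (model D V) _ (σ s) zero) p

    covered : ∀ d → Σ (Fin N) λ s → HasColour V (σ s) d
    covered d = let (s , c) = proj₁ (⋁-sat (model D V) _ _) (proj₂ (proj₁ sat) d)
            in s , proj₁ (colour-sat (model D V) _ (σ s) zero) c

    𝔓 : Model k
    𝔓 = model (D × Fin N) (productValuation V)

    sat𝔓 : Sat₀ 𝔓 φ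
    sat𝔓 = proj₁ (Sat-cong 𝔓 (λ ()) φ) (proj₁ (productTranslation-sat D V _ (λ ()) φ) (proj₂ sat))

    Related : D × Fin N → D → Set
    Related p d′ = (∀ a → a ∉ B → productValuation V a p ⟺ V a d′) × (∀ a → a ∈ B → productValuation V a p → V a d′)

    Related-total : ∀ p → Σ D (Related p)
    Related-total (d , s) with em {HasColour V (σ s) d}
    ... | yes c = let (w , cw , pw) = witness s in w ,
          (λ a q → ⟺-trans (productValuation-∉ V a d s q) (⟺-trans (c a q) (⟺-sym (cw a q)))) ,
          (λ a q u → pw a q (proj₁ (proj₁ (productValuation-∈ V a d s q) u)))
    ... | no nc = d , (λ a q → productValuation-∉ V a d s q) , (λ a q u → ⊥-elim (nc (proj₂ (proj₁ (productValuation-∈ V a d s q) u))))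

    Related-onto : ∀ d′ → Σ (D × Fin N) λ p → Related p d′
    Related-onto d′ with covered d′
    ... | s , _ with source s
    ...   | τ , m , _ with index-of-cleared m
    ...     | s′ , e = (d′ , s′) , (λ a q → productValuation-∉ V a d′ s′ q) ,
              (λ a q u → ⊥-elim (true≢false (trans (sym (proj₁ (proj₁ (productValuation-∈ V a d′ s′ q) u)))
                                  (trans (cong (λ v → lookup v a) (sym e)) (clearB-on τ a q)))))

    result : Sat₀ (model D V) φ
    result = Monotone-along-relation φ mon 𝔓 (model D V) Related (λ p d′ r → proj₁ r) (λ p d′ r → proj₂ r) Related-total Related-onto sat𝔓

  sumSnd : ∀ {X : Set} → List (X × ℕ) → ℕ
  sumSnd [] = 0
  sumSnd ((_ , i) ∷ xs) = i + sumSnd xs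

  sumSnd-≤ : ∀ {X : Set} (xs : List (X × ℕ)) {d i} → (d , i) ∈ₗ xs → i ≤ sumSnd xs
  sumSnd-≤ ((_ , j) ∷ xs) (here refl) = m≤m+n j (sumSnd xs)
  sumSnd-≤ ((_ , j) ∷ xs) (there m) = ≤-trans (sumSnd-≤ xs m) (m≤n+m (sumSnd xs) j)

  module Continuous⇒tM (em : ExcludedMiddle 0ℓ) (φ : Sentence k M) (cnt : Continuous B φ)
              (D : Set) (V : Fin k → D → Set) (sat : Sat₀ (model D V) φ) where
    -- ℕ copies of each point leave room for fresh copies without B-atoms under U.
    D′ : Set
    D′ = D × ℕ
    V′ : Fin k → D′ → Set
    V′ a p = V a (proj₁ p)

    sat′ : Sat₀ (model D′ V′) φ
    sat′ = proj₁ (copies-Sat₀ (model D V) φ) sat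

    shrunk : Σ (Valuation k D′) λ U → U ≤ω[ B ] V′ × Sat₀ (model D′ U) φ
    shrunk = proj₂ cnt D′ V′ (λ ()) sat′
    U : Fin k → D′ → Set
    U = proj₁ shrunk
    U⊆V′ : ∀ b → b ∈ B → ∀ e → U b e → V′ b e
    U⊆V′ = proj₁ (proj₁ (proj₁ (proj₂ shrunk)))
    U≈V′ : ∀ a → a ∉ B → ∀ e → U a e ⟺ V′ a e
    U≈V′ a p e = ⇔→⟺ (proj₂ (proj₁ (proj₁ (proj₂ shrunk))) a p e)
    satU : Sat₀ (model D′ U) φ
    satU = proj₂ (proj₂ shrunk)

    bSupport : List D′
    bSupport = proj₁ (≤ω-B-support-finite (proj₁ (proj₂ shrunk)))

    ∈bSupport : ∀ b → b ∈ B → ∀ e → U b e → e ∈ₗ bSupport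
    ∈bSupport b p e u = proj₂ (≤ω-B-support-finite (proj₁ (proj₂ shrunk))) e (b , p , u)

    fresh-copy : ∀ d → Σ ℕ λ i → ∀ b → b ∈ B → ¬ U b (d , i)
    fresh-copy d = suc (sumSnd bSupport) , λ b p u → <-irrefl refl (sumSnd-≤ bSupport (∈bSupport b p _ u))

    open TypeOf em

    𝔘 : Model k
    𝔘 = model D′ U

    Realized : Ty k → Set
    Realized τ = Σ D′ (HasTy 𝔘 τ)

    S : List (Ty k)
    S = filter (λ τ → em {Realized τ}) (allVecs k)

    memS : ∀ e → typeOf 𝔘 e ∈ₗ S
    memS e = ∈-filter⁺ (λ τ → em {Realized τ}) (allVecs-complete (typeOf 𝔘 e)) (e , typeOf-HasTy 𝔘 e)

    realS : ∀ {τ} → τ ∈ₗ S → Realized τ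
    realS m = proj₂ (∈-filter⁻ (λ τ → em {Realized τ}) {xs = allVecs k} m)

    open Product (withCleared S)
    open Facts S
    open Semantics em

    HasTy⇒HasColour : ∀ τ e → (∀ a → U a e ⟺ (lookup τ a ≡ true)) → HasColour V′ τ e
    HasTy⇒HasColour τ e h a p = ⟺-trans (⟺-sym (U≈V′ a p e)) (h a)

    witness : ∀ s → Σ D′ λ w → HasColour V′ (σ s) w × HasBPart V′ (σ s) w
    witness s with source s
    ... | τ , m , inj₁ qe with realS m
    ...   | e , h = e , subst (λ v → HasColour V′ v e) (sym qe) (HasTy⇒HasColour τ e h) ,
                    subst (λ v → HasBPart V′ v e) (sym qe) (λ a p l → U⊆V′ a p e (proj₂ (h a) l))
    witness s | τ , m , inj₂ qe with realS m
    ...   | e , h = e , subst (λ v → HasColour V′ v e) (sym qe)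
                      (λ a p → ⟺-trans (HasTy⇒HasColour τ e h a p) (subst (λ x → (lookup τ a ≡ true) ⟺ (x ≡ true)) (sym (clearB-off τ a p)) ⟺-refl)) ,
                    subst (λ v → HasBPart V′ v e) (sym qe) (λ a p l → ⊥-elim (true≢false (trans (sym l) (clearB-on τ a p))))

    covered : ∀ e → Σ (Fin N) λ s → HasColour V′ (σ s) e
    covered e with index-of-S (memS e)
    ... | s , qe = s , subst (λ v → HasColour V′ v e) qe (HasTy⇒HasColour (typeOf 𝔘 e) e (typeOf-HasTy 𝔘 e))

    Related : D′ → D′ × Fin N → Set
    Related e p = ∀ a → U a e ⟺ productValuation V′ a p

    fresh-related : ∀ d s → (∀ a → a ∈ B → ¬ productValuation V′ a (d , s)) → Σ D′ λ e → Related e (d , s)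
    fresh-related (d₀ , j) s h with fresh-copy d₀
    ... | i , fr = (d₀ , i) , λ a → f a (a ∈? B)
      where f : ∀ a → Dec (a ∈ B) → U a (d₀ , i) ⟺ productValuation V′ a ((d₀ , j) , s)
            f a (yes p) = (λ u → ⊥-elim (fr a p u)) , (λ u → ⊥-elim (h a p u))
            f a (no p) = ⟺-trans (U≈V′ a p (d₀ , i)) (⟺-sym (productValuation-∉ V′ a (d₀ , j) s p))

    Related-total : ∀ e → Σ (D′ × Fin N) (Related e)
    Related-total e with index-of-S (memS e)
    ... | s , qe = (e , s) , λ a → f a (a ∈? B)
      where f : ∀ a → Dec (a ∈ B) → U a e ⟺ productValuation V′ a (e , s)
            f a (no p) = ⟺-trans (U≈V′ a p e) (⟺-sym (productValuation-∉ V′ a e s p))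
            f a (yes p) = ⟺-trans (typeOf-HasTy 𝔘 e a) (⟺-trans
                (subst (λ v → (lookup (typeOf 𝔘 e) a ≡ true) ⟺ ((lookup v a ≡ true) × HasColour V′ v e)) qe
                   ((λ l → l , HasTy⇒HasColour (typeOf 𝔘 e) e (typeOf-HasTy 𝔘 e)) , proj₁))
                (⟺-sym (productValuation-∈ V′ a e s p)))

    Related-onto : ∀ p → Σ D′ λ e → Related e p
    Related-onto (d , s) with em {HasColour V′ (σ s) d}
    ... | no nc = fresh-related d s λ a p u → nc (proj₂ (proj₁ (productValuation-∈ V′ a d s p) u))
    ... | yes c with source s
    ...   | τ , m , inj₂ qe = fresh-related d s λ a p u →
              true≢false (trans (sym (proj₁ (proj₁ (productValuation-∈ V′ a d s p) u))) (trans (cong (λ v → lookup v a) qe) (clearB-on τ a p)))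
    ...   | τ , m , inj₁ qe with realS m
    ...     | e , h = e , λ a → f a (a ∈? B)
      where f : ∀ a → Dec (a ∈ B) → U a e ⟺ productValuation V′ a (d , s)
            f a (no p) = ⟺-trans (h a) (⟺-trans (subst (λ v → (lookup τ a ≡ true) ⟺ (lookup v a ≡ true)) (sym qe) ⟺-refl)
                           (⟺-trans (⟺-sym (c a p)) (⟺-sym (productValuation-∉ V′ a d s p))))
            f a (yes p) = ⟺-trans (h a) (⟺-trans (subst (λ v → (lookup τ a ≡ true) ⟺ (lookup v a ≡ true)) (sym qe) ⟺-refl)
                           (⟺-trans ((λ l → l , c) , proj₁) (⟺-sym (productValuation-∈ V′ a d s p))))

    𝔓 : Model k
    𝔓 = model (D′ × Fin N) (productValuation V′)

    sat𝔓 : Sat₀ 𝔓 φ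
    sat𝔓 = relation-preserves-Sat₀ (model D′ U) 𝔓 Related (λ e p r → r) Related-total Related-onto φ satU

    disjunct-holds : Sat₀ (model D′ V′) (disjunctM S φ)
    disjunct-holds = ((proj₂ (⋀-sat (model D′ V′) _ _) (λ s → let (w , c , p) = witness s in
                 w , proj₂ (colour-sat (model D′ V′) _ (σ s) zero) c , proj₂ (bPart-sat (model D′ V′) _ (σ s) zero) p)) ,
              (λ e → proj₂ (⋁-sat (model D′ V′) _ _) (let (s , c) = covered e in
                 s , proj₂ (colour-sat (model D′ V′) _ (σ s) zero) c))) ,
             proj₂ (productTranslation-sat D′ V′ _ (λ ()) φ) (proj₂ (Sat-cong 𝔓 (λ ()) φ) sat𝔓)

    result : Sat₀ (model D V) (tM φ)
    result = proj₂ (⋁ₗ-sat (model D V) _ _ (sublists (allVecs k)))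
               (S , filter∈sublists (λ τ → em {Realized τ}) (allVecs k) ,
                proj₂ (copies-Sat₀ (model D V) (disjunctM S φ)) disjunct-holds)

-- Counting Ehrenfeucht–Fraïssé games

depth : ∀ {k L n} → Formula k L n → ℕ
depth tt = 0
depth ff = 0
depth (pos a x) = 0
depth (neg a x) = 0
depth (eq x y) = 0
depth (neq x y) = 0
depth (φ ∨f ψ) = depth φ ⊔ depth ψ
depth (φ ∧f ψ) = depth φ ⊔ depth ψ
depth (ex φ) = suc (depth φ)
depth (all φ) = suc (depth φ)
depth (exInf φ) = suc (depth φ)
depth (allInf φ) = suc (depth φ)

AtLeast : {D : Set} → ℕ → (D → Set) → Set
AtLeast {D} m P = Σ (Fin m → D) λ f → (∀ i j → f i ≡ f j → i ≡ j) × (∀ i → P (f i))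

CountEq : {D₁ D₂ : Set} → ℕ → (D₁ → Set) → (D₂ → Set) → Set
CountEq j P Q = (∀ m → m ≤ j → AtLeast m P ⟺ AtLeast m Q) × (Finite P ⟺ Finite Q)

AtLeast-cong : ∀ {D : Set} {P Q : D → Set} {m} → (∀ d → P d ⟺ Q d) → AtLeast m P ⟺ AtLeast m Q
AtLeast-cong h = (λ { (f , i , p) → f , i , λ x → proj₁ (h _) (p x) }) , (λ { (f , i , p) → f , i , λ x → proj₂ (h _) (p x) })

AtLeast-mono : ∀ {D : Set} {P : D → Set} {m m′} → m ≤ m′ → AtLeast m′ P → AtLeast m P
AtLeast-mono le (f , i , p) = (λ x → f (inject≤ x le)) , (λ x y e → inject≤-injective le le x y (i _ _ e)) , λ x → p _

CountEq-cong : ∀ {D₁ D₂ : Set} {P P′ : D₁ → Set} {Q Q′ : D₂ → Set} {j} → (∀ d → P d ⟺ P′ d) → (∀ d → Q d ⟺ Q′ d) →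
  CountEq j P Q → CountEq j P′ Q′
CountEq-cong hp hq (a , f) = (λ m le → ⟺-trans (AtLeast-cong (λ d → ⟺-sym (hp d))) (⟺-trans (a m le) (AtLeast-cong hq))) ,
  ⟺-trans (Finite-cong (λ d → ⟺-sym (hp d))) (⟺-trans f (Finite-cong hq))

CountEq-mono : ∀ {D₁ D₂ : Set} {P : D₁ → Set} {Q : D₂ → Set} {j j′} → j ≤ j′ → CountEq j′ P Q → CountEq j P Q
CountEq-mono le (a , f) = (λ m le′ → a m (≤-trans le′ le)) , f

CountEq-sym : ∀ {D₁ D₂ : Set} {P : D₁ → Set} {Q : D₂ → Set} {j} → CountEq j P Q → CountEq j Q P
CountEq-sym (a , f) = (λ m le → ⟺-sym (a m le)) , ⟺-sym f

Outside : ∀ {k n} (𝔐 : Model k) → (Fin n → D 𝔐) → Ty k → D 𝔐 → Set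
Outside 𝔐 g τ d = HasTy 𝔐 τ d × (∀ i → ¬ d ≡ g i)

-- Winning positions of the depth-j counting Ehrenfeucht–Fraïssé game for ME∞.
Similar : ∀ {k n} → ℕ → (𝔐₁ 𝔐₂ : Model k) → (Fin n → D 𝔐₁) → (Fin n → D 𝔐₂) → Set
Similar {k} j 𝔐₁ 𝔐₂ g₁ g₂ = (∀ i a → V 𝔐₁ a (g₁ i) ⟺ V 𝔐₂ a (g₂ i)) ×
  (∀ i i′ → (g₁ i ≡ g₁ i′) ⟺ (g₂ i ≡ g₂ i′)) × (∀ (τ : Ty k) → CountEq j (Outside 𝔐₁ g₁ τ) (Outside 𝔐₂ g₂ τ))

Similar-sym : ∀ {k n j} {𝔐₁ 𝔐₂ : Model k} {g₁ g₂} → Similar {k} {n} j 𝔐₁ 𝔐₂ g₁ g₂ → Similar j 𝔐₂ 𝔐₁ g₂ g₁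
Similar-sym (a , e , c) = (λ i x → ⟺-sym (a i x)) , (λ i i′ → ⟺-sym (e i i′)) , λ τ → CountEq-sym (c τ)

module EhrenfeuchtFraisse (em : ExcludedMiddle 0ℓ) where
  open Classical em
  open TypeOf em

  remove : {D : Set} → (D → Set) → D → D → Set
  remove P d x = P x × ¬ x ≡ d

  AtLeast-suc⟺remove : {D : Set} {P : D → Set} {d : D} {m : ℕ} → P d → AtLeast (suc m) P ⟺ AtLeast m (remove P d)
  AtLeast-suc⟺remove {D} {P} {d} {m} pd = to , from
    where
      to : AtLeast (suc m) P → AtLeast m (remove P d)
      to (f , inj , p) with em {Σ (Fin (suc m)) λ i → f i ≡ d}
      ... | yes (i₀ , e) = (λ x → f (punchIn i₀ x)) , (λ x y q → punchIn-injective i₀ x y (inj _ _ q)) ,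
                           λ x → p _ , λ q → punchInᵢ≢i i₀ x (inj _ _ (trans q (sym e)))
      ... | no ne = (λ x → f (suc x)) , (λ x y q → suc-injective (inj _ _ q)) , λ x → p _ , λ q → ne (suc x , q)
      from : AtLeast m (remove P d) → AtLeast (suc m) P
      from (g , inj , p) = f , injf , pf
        where
          f : Fin (suc m) → D
          f zero = d
          f (suc x) = g x
          injf : ∀ x y → f x ≡ f y → x ≡ y
          injf zero zero q = refl
          injf zero (suc y) q = ⊥-elim (proj₂ (p y) (sym q))
          injf (suc x) zero q = ⊥-elim (proj₂ (p x) q)
          injf (suc x) (suc y) q = cong suc (inj x y q)
          pf : ∀ x → P (f x)
          pf zero = pd
          pf (suc x) = proj₁ (p x)

  Finite-remove⟺ : {D : Set} {P : D → Set} {d : D} → Finite (remove P d) ⟺ Finite P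
  Finite-remove⟺ {D} {P} {d} = (λ { (xs , h) → d ∷ xs , λ x px → f xs x px (em {x ≡ d}) h }) , Finite-mono (λ x → proj₁)
    where f : ∀ xs x → P x → Dec (x ≡ d) → (∀ y → remove P d y → y ∈ₗ xs) → x ∈ₗ (d ∷ xs)
          f xs x px (yes e) h = here e
          f xs x px (no ne) h = there (h x (px , ne))

  CountEq-remove : ∀ {D₁ D₂ : Set} {P : D₁ → Set} {Q : D₂ → Set} {j d₁ d₂} → CountEq (suc j) P Q → P d₁ → Q d₂ →
    CountEq j (remove P d₁) (remove Q d₂)
  CountEq-remove (a , f) p q = (λ m le → ⟺-trans (⟺-sym (AtLeast-suc⟺remove p)) (⟺-trans (a (suc m) (s≤s le)) (AtLeast-suc⟺remove q))) ,
    ⟺-trans Finite-remove⟺ (⟺-trans f (⟺-sym Finite-remove⟺))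

  Finite-by-types : ∀ {k n} (𝔐 : Model k) (g : Fin n → D 𝔐) {P : D 𝔐 → Set} →
    (∀ τ d → Outside 𝔐 g τ d → P d → Finite (Outside 𝔐 g τ)) → Finite P
  Finite-by-types {k} {n} 𝔐 g {P} fin = named ++ concatMap outsideOf (allVecs k) , λ d p → covers d p em
    where
      outsideOf′ : ∀ τ → Dec (Σ (D 𝔐) λ d → Outside 𝔐 g τ d × P d) → List (D 𝔐)
      outsideOf′ τ (yes (d , o , p)) = proj₁ (fin τ d o p)
      outsideOf′ τ (no _) = []
      outsideOf : Ty k → List (D 𝔐)
      outsideOf τ = outsideOf′ τ em
      named : List (D 𝔐)
      named = concatFin n (λ i → g i ∷ [])
      ∈outsideOf′ : ∀ τ d → Outside 𝔐 g τ d → P d → ∀ w → d ∈ₗ outsideOf′ τ w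
      ∈outsideOf′ τ d o p (yes (d′ , o′ , p′)) = proj₂ (fin τ d′ o′ p′) d o
      ∈outsideOf′ τ d o p (no nw) = ⊥-elim (nw (d , o , p))
      covers : ∀ d → P d → Dec (Σ (Fin n) λ i → d ≡ g i) → d ∈ₗ named ++ concatMap outsideOf (allVecs k)
      covers d p (yes (i , e)) = ∈-++⁺ˡ (concatFin-∈ n _ i (here e))
      covers d p (no ne) = ∈-++⁺ʳ named (∈-concatMap _ (allVecs k) (allVecs-complete (typeOf 𝔐 d))
        (∈outsideOf′ _ d (typeOf-HasTy 𝔐 d , λ i q → ne (i , q)) p em))

  module _ {k : ℕ} {𝔐₁ 𝔐₂ : Model k} where

    Match : ∀ {n} → (Fin n → D 𝔐₁) → (Fin n → D 𝔐₂) → D 𝔐₁ → D 𝔐₂ → Set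
    Match g₁ g₂ d₁ d₂ = (∀ a → V 𝔐₁ a d₁ ⟺ V 𝔐₂ a d₂) × (∀ i → (d₁ ≡ g₁ i) ⟺ (d₂ ≡ g₂ i))

    Outside-Match : ∀ {n} {g₁ : Fin n → D 𝔐₁} {g₂ : Fin n → D 𝔐₂} {d₁ d₂} τ → Match g₁ g₂ d₁ d₂ →
      Outside 𝔐₁ g₁ τ d₁ ⟺ Outside 𝔐₂ g₂ τ d₂
    Outside-Match τ (ma , me) = ×-cong (Π-cong λ a → (λ h → ⟺-trans (⟺-sym (ma a)) h) , λ h → ⟺-trans (ma a) h)
                                (Π-cong λ i → ¬-cong (me i))

    Outside-ext : ∀ {n} {𝔐 : Model k} (g : Fin n → D 𝔐) d τ x → Outside 𝔐 (ext g d) τ x ⟺ remove (Outside 𝔐 g τ) d x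
    Outside-ext g d τ x = (λ { (h , ne) → (h , λ i → ne (suc i)) , ne zero }) ,
                      λ { ((h , ne) , n0) → h , λ { zero → n0 ; (suc i) → ne i } }

    Similar-ext : ∀ {n j} {g₁ : Fin n → D 𝔐₁} {g₂ : Fin n → D 𝔐₂} → Similar (suc j) 𝔐₁ 𝔐₂ g₁ g₂ → ∀ {d₁ d₂} →
      Match g₁ g₂ d₁ d₂ → Similar j 𝔐₁ 𝔐₂ (ext g₁ d₁) (ext g₂ d₂)
    Similar-ext {g₁ = g₁} {g₂} (sa , se , sc) {d₁} {d₂} (ma , me) = at , eqs , cnt
      where
        at : ∀ i a → V 𝔐₁ a (ext g₁ d₁ i) ⟺ V 𝔐₂ a (ext g₂ d₂ i)
        at zero = ma
        at (suc i) = sa i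
        eqs : ∀ i i′ → (ext g₁ d₁ i ≡ ext g₁ d₁ i′) ⟺ (ext g₂ d₂ i ≡ ext g₂ d₂ i′)
        eqs zero zero = (λ _ → refl) , (λ _ → refl)
        eqs zero (suc i′) = me i′
        eqs (suc i) zero = (λ q → sym (proj₁ (me i) (sym q))) , (λ q → sym (proj₂ (me i) (sym q)))
        eqs (suc i) (suc i′) = se i i′
        cnt : ∀ τ → CountEq _ (Outside 𝔐₁ (ext g₁ d₁) τ) (Outside 𝔐₂ (ext g₂ d₂) τ)
        cnt τ with em {Outside 𝔐₁ g₁ τ d₁}
        ... | yes o₁ = CountEq-cong (λ x → ⟺-sym (Outside-ext {𝔐 = 𝔐₁} g₁ d₁ τ x)) (λ x → ⟺-sym (Outside-ext {𝔐 = 𝔐₂} g₂ d₂ τ x))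
                         (CountEq-remove (sc τ) o₁ (proj₁ (Outside-Match τ (ma , me)) o₁))
        ... | no no₁ = CountEq-cong (λ x → ⟺-trans ((λ o → o , λ q → no₁ (subst _ q o)) , proj₁) (⟺-sym (Outside-ext {𝔐 = 𝔐₁} g₁ d₁ τ x)))
                                  (λ x → ⟺-trans ((λ o → o , λ q → no₁ (proj₂ (Outside-Match τ (ma , me)) (subst _ q o))) , proj₁)
                                                 (⟺-sym (Outside-ext {𝔐 = 𝔐₂} g₂ d₂ τ x)))
                         (CountEq-mono (n≤1+n _) (sc τ))

    forth : ∀ {n j} {g₁ : Fin n → D 𝔐₁} {g₂ : Fin n → D 𝔐₂} → Similar (suc j) 𝔐₁ 𝔐₂ g₁ g₂ → ∀ d₁ →
      Σ (D 𝔐₂) (Match g₁ g₂ d₁)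
    forth {g₁ = g₁} {g₂} (sa , se , sc) d₁ with em {Σ _ λ i → d₁ ≡ g₁ i}
    ... | yes (i , refl) = g₂ i , sa i , se i
    ... | no ne with proj₁ (proj₁ (sc (typeOf 𝔐₁ d₁)) 1 (s≤s z≤n)) ((λ _ → d₁) , (λ { zero zero _ → refl }) , λ _ → typeOf-HasTy 𝔐₁ d₁ , λ i q → ne (i , q))
    ...   | f , _ , p with p zero
    ...     | (h₂ , ne₂) = f zero , (λ a → ⟺-trans (typeOf-HasTy 𝔐₁ d₁ a) (⟺-sym (h₂ a))) ,
                          λ i → (λ q → ⊥-elim (ne (i , q))) , λ q → ⊥-elim (ne₂ i q)

  Match-sym : ∀ {k n} {𝔐₁ 𝔐₂ : Model k} {g₁ : Fin n → D 𝔐₁} {g₂ : Fin n → D 𝔐₂} {d₁ d₂} →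
    Match {𝔐₁ = 𝔐₂} {𝔐₂ = 𝔐₁} g₂ g₁ d₂ d₁ → Match {𝔐₁ = 𝔐₁} {𝔐₂ = 𝔐₂} g₁ g₂ d₁ d₂
  Match-sym (ma , me) = (λ a → ⟺-sym (ma a)) , λ i → ⟺-sym (me i)

  Outside⇒Match : ∀ {k n} {𝔐₁ 𝔐₂ : Model k} {g₁ : Fin n → D 𝔐₁} {g₂ : Fin n → D 𝔐₂} {d₁ d₂} τ →
    Outside 𝔐₁ g₁ τ d₁ → Outside 𝔐₂ g₂ τ d₂ → Match {𝔐₁ = 𝔐₁} {𝔐₂ = 𝔐₂} g₁ g₂ d₁ d₂
  Outside⇒Match τ (h₁ , n₁) (h₂ , n₂) = (λ a → ⟺-trans (h₁ a) (⟺-sym (h₂ a))) ,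
    λ i → (λ q → ⊥-elim (n₁ i q)) , (λ q → ⊥-elim (n₂ i q))

  Similar⇒Sat : ∀ {k L n} (𝔐₁ 𝔐₂ : Model k) (φ : Formula k L n) j → depth φ ≤ j →
       {g₁ : Fin n → D 𝔐₁} {g₂ : Fin n → D 𝔐₂} → Similar j 𝔐₁ 𝔐₂ g₁ g₂ → Sat 𝔐₁ g₁ φ → Sat 𝔐₂ g₂ φ
  Similar⇒Sat 𝔐₁ 𝔐₂ tt j le s x = x
  Similar⇒Sat 𝔐₁ 𝔐₂ ff j le s x = x
  Similar⇒Sat 𝔐₁ 𝔐₂ (pos a x) j le s v = proj₁ (proj₁ s x a) v
  Similar⇒Sat 𝔐₁ 𝔐₂ (neg a x) j le s nv = λ v → nv (proj₂ (proj₁ s x a) v)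
  Similar⇒Sat 𝔐₁ 𝔐₂ (eq x y) j le s e = proj₁ (proj₁ (proj₂ s) x y) e
  Similar⇒Sat 𝔐₁ 𝔐₂ (neq x y) j le s ne = λ e → ne (proj₂ (proj₁ (proj₂ s) x y) e)
  Similar⇒Sat 𝔐₁ 𝔐₂ (φ ∨f ψ) j le s = [ (λ x → inj₁ (Similar⇒Sat 𝔐₁ 𝔐₂ φ j (≤-trans (m≤m⊔n _ _) le) s x)) ,
                              (λ x → inj₂ (Similar⇒Sat 𝔐₁ 𝔐₂ ψ j (≤-trans (m≤n⊔m _ _) le) s x)) ]
  Similar⇒Sat 𝔐₁ 𝔐₂ (φ ∧f ψ) j le s (x , y) = Similar⇒Sat 𝔐₁ 𝔐₂ φ j (≤-trans (m≤m⊔n _ _) le) s x , Similar⇒Sat 𝔐₁ 𝔐₂ ψ j (≤-trans (m≤n⊔m _ _) le) s y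
  Similar⇒Sat 𝔐₁ 𝔐₂ (ex φ) (suc j) (s≤s le) s (d₁ , x) with forth {𝔐₁ = 𝔐₁} {𝔐₂ = 𝔐₂} s d₁
  ... | d₂ , m = d₂ , Similar⇒Sat 𝔐₁ 𝔐₂ φ j le (Similar-ext {𝔐₁ = 𝔐₁} {𝔐₂ = 𝔐₂} s m) x
  Similar⇒Sat 𝔐₁ 𝔐₂ (all φ) (suc j) (s≤s le) s x d₂ with forth {𝔐₁ = 𝔐₂} {𝔐₂ = 𝔐₁} (Similar-sym s) d₂
  ... | d₁ , m = Similar⇒Sat 𝔐₁ 𝔐₂ φ j le (Similar-ext {𝔐₁ = 𝔐₁} {𝔐₂ = 𝔐₂} s (Match-sym {𝔐₁ = 𝔐₁} {𝔐₂ = 𝔐₂} m)) (x d₁)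
  Similar⇒Sat 𝔐₁ 𝔐₂ (exInf φ) (suc j) (s≤s le) {g₁} {g₂} s ninf fin₂ =
    ninf (Finite-by-types 𝔐₁ g₁ λ τ d₁ o₁ p₁ → proj₂ (proj₂ (proj₂ (proj₂ s) τ))
      (Finite-mono (λ d₂ o₂ → proj₂ fin₂ d₂ (Similar⇒Sat 𝔐₁ 𝔐₂ φ j le (Similar-ext {𝔐₁ = 𝔐₁} {𝔐₂ = 𝔐₂} s (Outside⇒Match {𝔐₁ = 𝔐₁} {𝔐₂ = 𝔐₂} τ o₁ o₂)) p₁)) (proj₁ fin₂ , λ _ x → x)))
  Similar⇒Sat 𝔐₁ 𝔐₂ (allInf φ) (suc j) (s≤s le) {g₁} {g₂} s fin₁ =
    Finite-by-types 𝔐₂ g₂ λ τ d₂ o₂ n₂ → proj₁ (proj₂ (proj₂ (proj₂ s) τ))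
      (Finite-mono (λ d₁ o₁ p₁ → n₂ (Similar⇒Sat 𝔐₁ 𝔐₂ φ j le (Similar-ext {𝔐₁ = 𝔐₁} {𝔐₂ = 𝔐₂} s (Outside⇒Match {𝔐₁ = 𝔐₁} {𝔐₂ = 𝔐₂} τ o₁ o₂)) p₁)) fin₁)

-- The translation for ME∞

module SubstituteB {k : ℕ} (B : Subset k) (m : ℕ) (Δ : Fin k → Formula k MEinf (suc m)) where

  substVar : ∀ {n} → Fin n → Fin (suc m) → Fin (n + m)
  substVar x zero = x ↑ˡ m
  substVar {n} x (suc j) = n ↑ʳ j

  substB : ∀ {n} → Formula k MEinf n → Formula k MEinf (n + m)
  substB tt = tt
  substB ff = ff
  substB (pos a x) = if does (a ∈? B) then ren (substVar x) (Δ a) else pos a (x ↑ˡ m)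
  substB (neg a x) = if does (a ∈? B) then ren (substVar x) (∼ (Δ a)) else neg a (x ↑ˡ m)
  substB (eq x y) = eq (x ↑ˡ m) (y ↑ˡ m)
  substB (neq x y) = neq (x ↑ˡ m) (y ↑ˡ m)
  substB (φ ∨f ψ) = substB φ ∨f substB ψ
  substB (φ ∧f ψ) = substB φ ∧f substB ψ
  substB (ex φ) = ex (substB φ)
  substB (all φ) = all (substB φ)
  substB (exInf φ) = exInf (substB φ)
  substB (allInf φ) = allInf (substB φ)

  substB-free : (∀ a → a ∈ B → Free B (Δ a)) → ∀ {n} (φ : Formula k MEinf n) → Free B (substB φ)
  substB-free h tt = tt
  substB-free h ff = ff
  substB-free h (pos a x) with a ∈? B
  ... | yes p = ren-free (substVar x) (h a p)
  ... | no p = pos a _ p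
  substB-free h (neg a x) with a ∈? B
  ... | yes p = ren-free (substVar x) (∼-free (h a p))
  ... | no p = neg a _ p
  substB-free h (eq x y) = eq _ _
  substB-free h (neq x y) = neq _ _
  substB-free h (φ ∨f ψ) = substB-free h φ ∨f substB-free h ψ
  substB-free h (φ ∧f ψ) = substB-free h φ ∧f substB-free h ψ
  substB-free h (ex φ) = ex (substB-free h φ)
  substB-free h (all φ) = all (substB-free h φ)
  substB-free h (exInf φ) = exInf (substB-free h φ)
  substB-free h (allInf φ) = allInf (substB-free h φ)

  definedValuation : {D : Set} → Valuation k D → (Fin m → D) → Valuation k D
  definedValuation {D} V x̄ = overrideB B (λ a y → Sat (model D V) (ext x̄ y) (Δ a)) V

  ext-↑ˡ : ∀ {D : Set} {n} (h : Fin (n + m) → D) d (i : Fin (suc n)) → ext h d (i ↑ˡ m) ≡ ext (λ i → h (i ↑ˡ m)) d i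
  ext-↑ˡ h d zero = refl
  ext-↑ˡ h d (suc i) = refl

  module Semantics (em : ExcludedMiddle 0ℓ) where
    open Classical em

    substB-sat : ∀ {n} (D : Set) (V : Fin k → D → Set) (h : Fin (n + m) → D) (φ : Formula k MEinf n) →
      Sat (model D V) h (substB φ) ⟺ Sat (model D (definedValuation V (λ j → h (n ↑ʳ j)))) (λ i → h (i ↑ˡ m)) φ
    substB-sat D V h tt = ⟺-refl
    substB-sat D V h ff = ⟺-refl
    substB-sat {n} D V h (pos a x) with a ∈? B
    ... | no _ = ⟺-refl
    ... | yes _ = ren-sat (model D V) (substVar x) (λ { zero → refl ; (suc j) → refl }) (Δ a)
    substB-sat {n} D V h (neg a x) with a ∈? B
    ... | no _ = ⟺-refl
    ... | yes _ = ⟺-trans (ren-sat (model D V) (substVar x) {h = ext (λ j → h (n ↑ʳ j)) (h (x ↑ˡ m))} (λ { zero → refl ; (suc j) → refl }) (∼ (Δ a)))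
                   (∼-sat (model D V) _ (Δ a))
    substB-sat D V h (eq x y) = ⟺-refl
    substB-sat D V h (neq x y) = ⟺-refl
    substB-sat D V h (φ ∨f ψ) = ⊎-cong (substB-sat D V h φ) (substB-sat D V h ψ)
    substB-sat D V h (φ ∧f ψ) = ×-cong (substB-sat D V h φ) (substB-sat D V h ψ)
    substB-sat D V h (ex φ) = Σ-cong λ d → ⟺-trans (substB-sat D V (ext h d) φ) (Sat-cong _ (ext-↑ˡ h d) φ)
    substB-sat D V h (all φ) = Π-cong λ d → ⟺-trans (substB-sat D V (ext h d) φ) (Sat-cong _ (ext-↑ˡ h d) φ)
    substB-sat D V h (exInf φ) = ¬-cong (Finite-cong λ d → ⟺-trans (substB-sat D V (ext h d) φ) (Sat-cong _ (ext-↑ˡ h d) φ))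
    substB-sat D V h (allInf φ) = Finite-cong λ d → ¬-cong (⟺-trans (substB-sat D V (ext h d) φ) (Sat-cong _ (ext-↑ˡ h d) φ))

Distinct : {X : Set} → List X → Set
Distinct [] = ⊤
Distinct (x ∷ xs) = (¬ x ∈ₗ xs) × Distinct xs

Distinct-++ : {X : Set} (xs ys : List X) → Distinct xs → Distinct ys → (∀ x → x ∈ₗ xs → x ∈ₗ ys → ⊥) → Distinct (xs ++ ys)
Distinct-++ [] ys dx dy dj = dy
Distinct-++ (x ∷ xs) ys (nx , dx) dy dj = (λ m → [ nx , dj x (here refl) ] (∈-++⁻ xs m)) , Distinct-++ xs ys dx dy (λ z m → dj z (there m))

∈-concatMap⁻ : ∀ {A X : Set} (f : A → List X) (as : List A) {x} → x ∈ₗ concatMap f as → Σ A λ a → a ∈ₗ as × x ∈ₗ f a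
∈-concatMap⁻ f (a ∷ as) m with ∈-++⁻ (f a) m
... | inj₁ m′ = a , here refl , m′
... | inj₂ m′ = let (b , mb , mx) = ∈-concatMap⁻ f as m′ in b , there mb , mx

Distinct-concatMap : ∀ {A X : Set} (f : A → List X) (as : List A) → Distinct as → (∀ a → Distinct (f a)) →
  (∀ a b x → x ∈ₗ f a → x ∈ₗ f b → a ≡ b) → Distinct (concatMap f as)
Distinct-concatMap f [] da df dj = tt
Distinct-concatMap f (a ∷ as) (na , da) df dj = Distinct-++ (f a) _ (df a) (Distinct-concatMap f as da df dj)
  λ x m₁ m₂ → let (b , mb , mx) = ∈-concatMap⁻ f as m₂ in na (subst (_∈ₗ as) (sym (dj a b x m₁ mx)) mb)

Distinct-map : {X Y : Set} (f : X → Y) → (∀ x y → f x ≡ f y → x ≡ y) → (xs : List X) → Distinct xs → Distinct (map f xs)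
Distinct-map f inj [] d = tt
Distinct-map f inj (x ∷ xs) (nx , d) = (λ m → let (y , my , e) = ∈-map⁻ f m in nx (subst (_∈ₗ xs) (sym (inj _ _ e)) my)) , Distinct-map f inj xs d

Distinct-allVecs : ∀ k → Distinct (allVecs k)
Distinct-allVecs zero = (λ ()) , tt
Distinct-allVecs (suc k) = Distinct-++ _ _ (Distinct-map _ (λ { _ _ refl → refl }) _ (Distinct-allVecs k)) (Distinct-map _ (λ { _ _ refl → refl }) _ (Distinct-allVecs k))
  λ x m₁ m₂ → let (_ , _ , e₁) = ∈-map⁻ (true ∷_) m₁ ; (_ , _ , e₂) = ∈-map⁻ (false ∷_) m₂ in f (trans (sym e₁) e₂)
  where f : ∀ {v w : Vec Bool k} → (true ∷ v) ≡ (false ∷ w) → ⊥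
        f ()

count : ∀ {k} → Vec Bool k → List (Vec Bool k) → ℕ
count σ [] = 0
count σ (x ∷ xs) with ≡-dec _≟B_ x σ
... | yes _ = suc (count σ xs)
... | no _ = count σ xs

count-++ : ∀ {k} (σ : Vec Bool k) xs ys → count σ xs + count σ ys ≡ count σ (xs ++ ys)
count-++ σ [] ys = refl
count-++ σ (x ∷ xs) ys with ≡-dec _≟B_ x σ
... | yes _ = cong suc (count-++ σ xs ys)
... | no _ = count-++ σ xs ys

count-positions : ∀ {k} (σ : Vec Bool k) (xs : List (Vec Bool k)) q → q ≤ count σ xs →
  Σ (Fin q → Fin (length xs)) λ f → (∀ i j → f i ≡ f j → i ≡ j) × (∀ i → lookupₗ xs (f i) ≡ σ)
count-positions σ xs zero le = (λ ()) , (λ ()) , λ ()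
count-positions σ (x ∷ xs) (suc q) le with ≡-dec _≟B_ x σ
count-positions σ (x ∷ xs) (suc q) (s≤s le) | yes e with count-positions σ xs q le
... | f , inj , p = g , ginj , gp
  where g : Fin (suc q) → Fin (suc (length xs))
        g zero = zero
        g (suc i) = suc (f i)
        ginj : ∀ i j → g i ≡ g j → i ≡ j
        ginj zero zero _ = refl
        ginj zero (suc j) ()
        ginj (suc i) zero ()
        ginj (suc i) (suc j) q = cong suc (inj i j (suc-injective q))
        gp : ∀ i → lookupₗ (x ∷ xs) (g i) ≡ σ
        gp zero = e
        gp (suc i) = p i
count-positions σ (x ∷ xs) (suc q) le | no _ with count-positions σ xs (suc q) le
... | f , inj , p = (λ i → suc (f i)) , (λ i j q → inj i j (suc-injective q)) , p

lookupP : {X Y : Set} (wl : List (X × Y)) → Fin (length (map proj₂ wl)) → X × Y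
lookupP (p ∷ wl) zero = p
lookupP (p ∷ wl) (suc i) = lookupP wl i

lookupP-snd : {X Y : Set} (wl : List (X × Y)) (i : Fin (length (map proj₂ wl))) → lookupₗ (map proj₂ wl) i ≡ proj₂ (lookupP wl i)
lookupP-snd (p ∷ wl) zero = refl
lookupP-snd (p ∷ wl) (suc i) = lookupP-snd wl i

lookupP-∈ : {X Y : Set} (wl : List (X × Y)) (i : Fin (length (map proj₂ wl))) → lookupP wl i ∈ₗ wl
lookupP-∈ (p ∷ wl) zero = here refl
lookupP-∈ (p ∷ wl) (suc i) = there (lookupP-∈ wl i)

lookupP-idx : {X Y : Set} (wl : List (X × Y)) {p : X × Y} → p ∈ₗ wl → Σ (Fin (length (map proj₂ wl))) λ i → lookupP wl i ≡ p
lookupP-idx (p ∷ wl) (here refl) = zero , refl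
lookupP-idx (p ∷ wl) (there m) = let (i , e) = lookupP-idx wl m in suc i , e

lookupP-inj : {X Y : Set} (wl : List (X × Y)) → Distinct (map proj₁ wl) → (i j : Fin (length (map proj₂ wl))) →
  proj₁ (lookupP wl i) ≡ proj₁ (lookupP wl j) → i ≡ j
lookupP-inj (p ∷ wl) d zero zero e = refl
lookupP-inj (p ∷ wl) (np , d) zero (suc j) e = ⊥-elim (np (subst (_∈ₗ map proj₁ wl) (sym e) (∈-map⁺ proj₁ (lookupP-∈ wl j))))
lookupP-inj (p ∷ wl) (np , d) (suc i) zero e = ⊥-elim (np (subst (_∈ₗ map proj₁ wl) e (∈-map⁺ proj₁ (lookupP-∈ wl i))))
lookupP-inj (p ∷ wl) (np , d) (suc i) (suc j) e = cong suc (lookupP-inj wl d i j e)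

allLists : {A : Set} → ℕ → List A → List (List A)
allLists zero as = [] ∷ []
allLists (suc Mx) as = [] ∷ concatMap (λ a → map (a ∷_) (allLists Mx as)) as

allLists-∈ : {A : Set} (Mx : ℕ) (as xs : List A) → length xs ≤ Mx → (∀ x → x ∈ₗ xs → x ∈ₗ as) → xs ∈ₗ allLists Mx as
allLists-∈ zero as [] le h = here refl
allLists-∈ (suc Mx) as [] le h = here refl
allLists-∈ (suc Mx) as (x ∷ xs) (s≤s le) h =
  there (∈-concatMap _ as (h x (here refl)) (∈-map⁺ (x ∷_) (allLists-∈ Mx as xs le (λ y m → h y (there m)))))

length-concatMap : ∀ {A X : Set} (f : A → List X) (as : List A) q → (∀ a → length (f a) ≤ q) → length (concatMap f as) ≤ length as * q
length-concatMap f [] q h = z≤n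
length-concatMap f (a ∷ as) q h rewrite length-++ (f a) {concatMap f as} = +-mono-≤ (h a) (length-concatMap f as q h)

tabulate-Distinct : {X : Set} (n : ℕ) (f : Fin n → X) → (∀ i j → f i ≡ f j → i ≡ j) → Distinct (List.tabulate f)
tabulate-Distinct zero f inj = tt
tabulate-Distinct (suc n) f inj = (λ m → let (i , e) = ∈-tabulate⁻ m in g (inj _ _ e)) ,
  tabulate-Distinct n (λ i → f (suc i)) (λ i j e → suc-injective (inj _ _ e))
  where g : ∀ {i : Fin n} → zero ≡ suc i → ⊥
        g ()

existsN : ∀ {k L} (m : ℕ) → Formula k L m → Formula k L 0
existsN zero φ = φ
existsN (suc m) φ = existsN m (ex φ)

existsN-sat : ∀ {k L} (𝔐 : Model k) (m : ℕ) (φ : Formula k L m) → Sat₀ 𝔐 (existsN m φ) ⟺ Σ (Fin m → D 𝔐) λ h → Sat 𝔐 h φ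
existsN-sat 𝔐 zero φ = (λ s → (λ ()) , proj₁ (Sat-cong 𝔐 (λ ()) φ) s) , λ { (h , s) → proj₁ (Sat-cong 𝔐 (λ ()) φ) s }
existsN-sat 𝔐 (suc m) φ = ⟺-trans (existsN-sat 𝔐 m (ex φ))
  ((λ { (g , d , s) → ext g d , s }) ,
   λ { (h , s) → (λ i → h (suc i)) , h zero , proj₁ (Sat-cong 𝔐 (λ { zero → refl ; (suc i) → refl }) φ) s })

distinct : ∀ {k} (m : ℕ) → Formula k MEinf m
distinct m = ⋀ (λ i → ⋀ (λ j → if does (i ≟F j) then tt else neq i j))

distinct-sat : ∀ {k m} (𝔐 : Model k) (h : Fin m → D 𝔐) → Sat 𝔐 h (distinct m) ⟺ (∀ i j → h i ≡ h j → i ≡ j)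
distinct-sat 𝔐 h = ⟺-trans (⋀-sat 𝔐 h _) ((λ f i j e → to i j (proj₁ (⋀-sat 𝔐 h _) (f i) j) e) ,
                                            λ inj i → proj₂ (⋀-sat 𝔐 h _) λ j → fr i j inj)
  where
    to : ∀ i j → Sat 𝔐 h (if does (i ≟F j) then tt else neq i j) → h i ≡ h j → i ≡ j
    to i j s e with i ≟F j
    ... | yes p = p
    ... | no _ = ⊥-elim (s e)
    fr : ∀ i j → (∀ i j → h i ≡ h j → i ≡ j) → Sat 𝔐 h (if does (i ≟F j) then tt else neq i j)
    fr i j inj with i ≟F j
    ... | yes _ = tt
    ... | no p = λ e → p (inj i j e)

distinct-free : ∀ {k} {B : Subset k} (m : ℕ) → Free B (distinct {k} m)
distinct-free m = ⋀-free _ λ i → ⋀-free _ λ j → f i j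
  where f : ∀ i j → Free _ (if does (i ≟F j) then tt else neq i j)
        f i j with i ≟F j
        ... | yes _ = tt
        ... | no _ = neq i j

module Enumeration (em : ExcludedMiddle 0ℓ) where
  open Classical em

  open EhrenfeuchtFraisse em using (remove; AtLeast-suc⟺remove)

  enumerate-small : {X : Set} (P : X → Set) (q : ℕ) → ¬ AtLeast q P →
    Σ (List X) λ xs → Distinct xs × (∀ d → P d ⟺ d ∈ₗ xs) × length xs < q
  enumerate-small P zero na = ⊥-elim (na ((λ ()) , (λ ()) , λ ()))
  enumerate-small P (suc q) na with em {Σ _ P}
  ... | no ne = [] , tt , (λ d → (λ p → ⊥-elim (ne (d , p))) , λ ()) , s≤s z≤n
  ... | yes (d , pd) with enumerate-small (remove P d) q (λ a → na (proj₂ (AtLeast-suc⟺remove pd) a))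
  ...   | xs , dx , h , len = d ∷ xs , ((λ m → proj₂ (proj₂ (h d) m) refl) , dx) ,
          (λ y → (λ py → f y py (em {y ≡ d})) , λ { (here refl) → pd ; (there m) → proj₁ (proj₂ (h y) m) }) , s≤s len
    where f : ∀ y → P y → Dec (y ≡ d) → y ∈ₗ (d ∷ xs)
          f y py (yes e) = here e
          f y py (no ne) = there (proj₁ (h y) (py , ne))

⋁ₗ-free : ∀ {k L n} {B : Subset k} {A : Set} (f : A → Formula k L n) (xs : List A) → (∀ x → Free B (f x)) → Free B (⋁ₗ f xs)
⋁ₗ-free f [] h = ff
⋁ₗ-free f (x ∷ xs) h = h x ∨f ⋁ₗ-free f xs h

existsN-SynCont : ∀ {k L} {B : Subset k} (m : ℕ) {φ : Formula k L m} → SynCont B φ → SynCont B (existsN m φ)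
existsN-SynCont zero c = c
existsN-SynCont (suc m) c = existsN-SynCont m (ex c)

boolF : ∀ {k L n} → Bool → Formula k L n
boolF true = tt
boolF false = ff

boolF-sat : ∀ {k L n} (𝔐 : Model k) (g : Fin n → D 𝔐) x → Sat 𝔐 g (boolF {k} {L} x) ⟺ (x ≡ true)
boolF-sat 𝔐 g true = (λ _ → refl) , λ _ → tt
boolF-sat 𝔐 g false = (λ ()) , λ ()

boolF-free : ∀ {k L n} {B : Subset k} x → Free B (boolF {k} {L} {n} x)
boolF-free true = tt
boolF-free false = ff

module TranslationME {k : ℕ} (B : Subset k) where
  open TypeFormulas B

  allTypes : List (Ty k)
  allTypes = allVecs k

  -- A profile (NL , Ext , Big) describes U ≤ω V: NL lists the types of named points, namely
  -- all points of types realised fewer than q times and q points of each type in Ext; Ext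
  -- and Big are the types realised at least q times with, respectively without, a B-atom.
  Profile : Set
  Profile = List (Ty k) × List (Ty k) × List (Ty k)

  allProfiles : ℕ → List Profile
  allProfiles q = concatMap (λ NL → concatMap (λ E → map (λ Bg → (NL , E , Bg)) (sublists allTypes)) (sublists allTypes)) (allLists (length allTypes * q) allTypes)

  module Disjunct (q : ℕ) (ι : Profile) where
    NL Ext Big : List (Ty k)
    NL = proj₁ ι
    Ext = proj₁ (proj₂ ι)
    Big = proj₂ (proj₂ ι)

    m : ℕ
    m = length NL

    nty : Fin m → Ty k
    nty = lookupₗ NL

    ψF : Formula k MEinf (suc m)
    ψF = ⋁ (λ i → eq zero (suc i)) ∨f ⋁ₗ (λ σ → colour σ zero) Big

    αF : Formula k MEinf (suc m)
    αF = ⋁ₗ (λ σ → colour σ zero ∧f bPart σ zero) Ext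

    selF : List (Ty k) → Fin k → Formula k MEinf (suc m)
    selF [] b = ff
    selF (σ ∷ E) b = (colour σ zero ∧f boolF (lookup σ b)) ∨f (∼ (colour σ zero) ∧f selF E b)

    -- The definition of b ∈ B: the named points carry their listed types, and the finitely
    -- many points failing ψF take the B-part of the first Ext type whose colour they have.
    Δ : Fin k → Formula k MEinf (suc m)
    Δ b = ⋁ (λ i → boolF (lookup (nty i) b) ∧f eq zero (suc i)) ∨f (∼ ψF ∧f selF Ext b)

    open SubstituteB B m Δ public

    named : Formula k MEinf m
    named = ⋀ (λ i → colour (nty i) i ∧f bPart (nty i) i)

    body : Sentence k MEinf → Formula k MEinf m
    body φ = ((distinct m ∧f named) ∧f Wq αF ψF) ∧f substB φ

    WF : Set
    WF = All (λ σ → q ≤ count σ NL) Ext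

    wf? : Dec WF
    wf? = all? (λ σ → q ≤? count σ NL) Ext

    disjunctME : Sentence k MEinf → Sentence k MEinf
    disjunctME φ = if does wf? then existsN m (body φ) else ff

    ψF-free : Free B ψF
    ψF-free = ⋁-free _ (λ i → eq zero (suc i)) ∨f ⋁ₗ-free _ Big (λ σ → colour-free σ zero)

    selF-free : ∀ E b → Free B (selF E b)
    selF-free [] b = ff
    selF-free (σ ∷ E) b = (colour-free σ zero ∧f boolF-free _) ∨f (∼-free (colour-free σ zero) ∧f selF-free E b)

    Δ-free : ∀ b → Free B (Δ b)
    Δ-free b = ⋁-free _ (λ i → boolF-free _ ∧f eq zero (suc i)) ∨f (∼-free ψF-free ∧f selF-free Ext b)

    disjunctME-SynCont : (φ : Sentence k MEinf) → SynCont B (disjunctME φ)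
    disjunctME-SynCont φ with wf?
    ... | no _ = base ff
    ... | yes _ = existsN-SynCont m ((((base (distinct-free m)) ∧c ⋀-SynCont _ (λ i → base (colour-free (nty i) i) ∧c bPart-SynCont (nty i) i)) ∧c
                   W (⋁ₗ-SynCont _ Ext (λ σ → base (colour-free σ zero) ∧c bPart-SynCont σ zero)) ψF-free) ∧c
                   base (substB-free (λ a _ → Δ-free a) φ))

  tE : Sentence k MEinf → Sentence k MEinf
  tE φ = ⋁ₗ (λ ι → Disjunct.disjunctME (depth φ) ι φ) (allProfiles (depth φ))

  tE-SynCont : (φ : Sentence k MEinf) → SynCont B (tE φ)
  tE-SynCont φ = ⋁ₗ-SynCont _ _ λ ι → Disjunct.disjunctME-SynCont (depth φ) ι φ

Selected : ∀ {k} → (Ty k → Set) → List (Ty k) → Fin k → Set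
Selected T [] b = ⊥
Selected T (σ ∷ E) b = (T σ × lookup σ b ≡ true) ⊎ (¬ T σ × Selected T E b)

Selected-witness : ∀ {k} (T : Ty k → Set) E b → Selected T E b → Σ (Ty k) λ σ → σ ∈ₗ E × T σ × lookup σ b ≡ true
Selected-witness T (σ ∷ E) b (inj₁ (t , l)) = σ , here refl , t , l
Selected-witness T (σ ∷ E) b (inj₂ (_ , s)) = let (σ′ , m , t , l) = Selected-witness T E b s in σ′ , there m , t , l

CountEq-refl : ∀ {X : Set} {P : X → Set} {j} → CountEq j P P
CountEq-refl = (λ m le → ⟺-refl) , ⟺-refl

Outside₀ : ∀ {k} (𝔐 : Model k) τ (g : Fin 0 → D 𝔐) d → Outside 𝔐 g τ d ⟺ HasTy 𝔐 τ d
Outside₀ 𝔐 τ g d = proj₁ , λ h → h , λ ()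

module DisjunctSemantics (em : ExcludedMiddle 0ℓ) {k : ℕ} (B : Subset k) where
  open Classical em
  open TypeFormulas B
  open TranslationME B

  first-selected : (T : Ty k → Set) (E : List (Ty k)) → (Σ (Ty k) λ σ → σ ∈ₗ E × T σ) →
    Σ (Ty k) λ σ → σ ∈ₗ E × T σ × (∀ b → Selected T E b ⟺ (lookup σ b ≡ true))
  first-selected T (σ ∷ E) w with em {T σ}
  ... | yes t = σ , here refl , t , λ b → [ proj₂ , (λ p → ⊥-elim (proj₁ p t)) ] , λ l → inj₁ (t , l)
  ... | no nt with w
  ...   | σ′ , here refl , t′ = ⊥-elim (nt t′)
  ...   | σ′ , there m , t′ with first-selected T E (σ′ , m , t′)
  ...     | σ₁ , m₁ , t₁ , h₁ = σ₁ , there m₁ , t₁ , λ b → [ (λ p → ⊥-elim (nt (proj₁ p))) , (λ p → proj₁ (h₁ b) (proj₂ p)) ] ,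
                                  λ l → inj₂ (nt , proj₂ (h₁ b) l)

  module DisjunctAt (q : ℕ) (ι : Profile) {D : Set} (V : Fin k → D → Set) (h : Fin (Disjunct.m q ι) → D) where
    open Disjunct q ι
    𝔐 : Model k
    𝔐 = model D V

    ψS : D → Set
    ψS y = (Σ (Fin m) λ i → y ≡ h i) ⊎ (Σ (Ty k) λ σ → σ ∈ₗ Big × HasColour V σ y)

    ψ-sat : ∀ y → Sat 𝔐 (ext h y) ψF ⟺ ψS y
    ψ-sat y = ⊎-cong (⋁-sat 𝔐 (ext h y) _)
      (⟺-trans (⋁ₗ-sat 𝔐 (ext h y) _ Big) (Σ-cong λ σ → ×-cong ⟺-refl (colour-sat 𝔐 (ext h y) σ zero)))

    α-sat : ∀ y → Sat 𝔐 (ext h y) αF ⟺ (Σ (Ty k) λ σ → σ ∈ₗ Ext × HasColour V σ y × HasBPart V σ y)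
    α-sat y = ⟺-trans (⋁ₗ-sat 𝔐 (ext h y) _ Ext)
      (Σ-cong λ σ → ×-cong ⟺-refl (×-cong (colour-sat 𝔐 (ext h y) σ zero) (bPart-sat 𝔐 (ext h y) σ zero)))

    Coloured : D → Ty k → Set
    Coloured y σ = HasColour V σ y

    sel-sat : ∀ y E b → Sat 𝔐 (ext h y) (selF E b) ⟺ Selected (Coloured y) E b
    sel-sat y [] b = ⟺-refl
    sel-sat y (σ ∷ E) b = ⊎-cong (×-cong (colour-sat 𝔐 (ext h y) σ zero) (boolF-sat 𝔐 (ext h y) _))
      (×-cong (⟺-trans (∼-sat 𝔐 (ext h y) (colour σ zero)) (¬-cong (colour-sat 𝔐 (ext h y) σ zero))) (sel-sat y E b))

    ΔS : D → Fin k → Set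
    ΔS y b = (Σ (Fin m) λ i → lookup (nty i) b ≡ true × y ≡ h i) ⊎ (¬ ψS y × Selected (Coloured y) Ext b)

    Δ-sat : ∀ y b → Sat 𝔐 (ext h y) (Δ b) ⟺ ΔS y b
    Δ-sat y b = ⊎-cong (⟺-trans (⋁-sat 𝔐 (ext h y) _) (Σ-cong λ i → ×-cong (boolF-sat 𝔐 (ext h y) _) ⟺-refl))
      (×-cong (⟺-trans (∼-sat 𝔐 (ext h y) ψF) (¬-cong (ψ-sat y))) (sel-sat y Ext b))

    UP : Fin k → D → Set
    UP = definedValuation V h

    UP-on : ∀ b y → b ∈ B → UP b y ⟺ ΔS y b
    UP-on b y p = ⟺-trans (overrideB-∈⟺ B (λ a y → Sat 𝔐 (ext h y) (Δ a)) V p y) (Δ-sat y b)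

    UP-off : ∀ a y → a ∉ B → UP a y ⟺ V a y
    UP-off a y p = overrideB-∉⟺ B (λ a y → Sat 𝔐 (ext h y) (Δ a)) V p y

    module NamedShape (Sel′ : D → Fin k → Set) (U : Fin k → D → Set)
                 (Uon : ∀ b y → b ∈ B → U b y ⟺ ((Σ (Fin m) λ i → lookup (nty i) b ≡ true × y ≡ h i) ⊎ (¬ ψS y × Sel′ y b)))
                 (Uoff : ∀ a y → a ∉ B → U a y ⟺ V a y) where

      named-ty : (∀ i j → h i ≡ h j → i ≡ j) → (∀ i → HasColour V (nty i) (h i)) → ∀ i → HasTy (model D U) (nty i) (h i)
      named-ty inj colour i a with em {a ∈ B}
      ... | no p = ⟺-trans (Uoff a (h i) p) (colour i a p)
      ... | yes p = ⟺-trans (Uon a (h i) p)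
          ([ (λ { (j , l , e) → subst (λ x → lookup (nty x) a ≡ true) (inj j i (sym e)) l }) ,
             (λ r → ⊥-elim (proj₁ r (inj₁ (i , refl)))) ] ,
           λ l → inj₁ (i , l , refl))

      psi-ty : ∀ y → ψS y → ¬ (Σ (Fin m) λ i → y ≡ h i) → ∀ b → b ∈ B → ¬ U b y
      psi-ty y ps nn b p u = [ (λ { (i , _ , e) → nn (i , e) }) , (λ r → proj₁ r ps) ] (proj₁ (Uon b y p) u)

      nonpsi-ty : ∀ y → ¬ ψS y → ∀ b → b ∈ B → U b y ⟺ Sel′ y b
      nonpsi-ty y nps b p = ⟺-trans (Uon b y p) ([ (λ { (i , _ , e) → ⊥-elim (nps (inj₁ (i , e))) }) , proj₂ ] , λ s → inj₂ (nps , s))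

  module DisjunctME⇒φ (q : ℕ) (ι : Profile) (φ : Sentence k MEinf) (dq : depth φ ≤ q) (mon : Monotone B φ)
               (D : Set) (V : Fin k → D → Set) where
    open Disjunct q ι

    module Witnessed (wf : WF) (h : Fin m → D) (sat : Sat (model D V) h (body φ)) where
      open DisjunctAt q ι V h
      open SubstituteB.Semantics B m Δ em

      inj : ∀ i j → h i ≡ h j → i ≡ j
      inj = proj₁ (distinct-sat (model D V) h) (proj₁ (proj₁ (proj₁ sat)))

      nOK : ∀ i → HasColour V (nty i) (h i) × HasBPart V (nty i) (h i)
      nOK i = let (c , p) = proj₁ (⋀-sat (model D V) h _) (proj₂ (proj₁ (proj₁ sat))) i in
              proj₁ (colour-sat (model D V) h (nty i) i) c , proj₁ (bPart-sat (model D V) h (nty i) i) p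

      αψ : ∀ y → (Σ (Ty k) λ σ → σ ∈ₗ Ext × HasColour V σ y × HasBPart V σ y) ⊎ ψS y
      αψ y = [ (λ a → inj₁ (proj₁ (α-sat y) a)) , (λ b → inj₂ (proj₁ (ψ-sat y) b)) ]′ (proj₁ (proj₂ (proj₁ sat)) y)

      finψ : Finite (λ y → ¬ ψS y)
      finψ = proj₁ (Finite-cong λ y → ¬-cong (ψ-sat y)) (proj₂ (proj₂ (proj₁ sat)))

      satUP : Sat₀ (model D UP) φ
      satUP = proj₁ (Sat-cong (model D UP) (λ ()) φ) (proj₁ (substB-sat D V h φ) (proj₂ sat))

      Good : D → Ty k → Set
      Good y σ = HasColour V σ y × HasBPart V σ y
      -- U′ differs from UP only on the finitely many points failing ψ, which have types in Ext
      -- under both; as each Ext type has q named points, UP and U′ are q-similar, and U′ ≤ V.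
      U′ᴮ : Valuation k D
      U′ᴮ a y = (Σ (Fin m) λ i → lookup (nty i) a ≡ true × y ≡ h i) ⊎ (¬ ψS y × Selected (Good y) Ext a)

      U′ : Valuation k D
      U′ = overrideB B U′ᴮ V
      U′-on : ∀ b y → b ∈ B → U′ b y ⟺ ((Σ (Fin m) λ i → lookup (nty i) b ≡ true × y ≡ h i) ⊎ (¬ ψS y × Selected (Good y) Ext b))
      U′-on b y p = overrideB-∈⟺ B U′ᴮ V p y
      U′-off : ∀ a y → a ∉ B → U′ a y ⟺ V a y
      U′-off a y p = overrideB-∉⟺ B U′ᴮ V p y

      module S₁ = NamedShape (λ y → Selected (Coloured y) Ext) UP UP-on UP-off
      module S₂ = NamedShape (λ y → Selected (Good y) Ext) U′ U′-on U′-off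

      same-ψ : ∀ y → ψS y → ∀ a → UP a y ⟺ U′ a y
      same-ψ y ps a with em {a ∈ B}
      ... | no p = ⟺-trans (UP-off a y p) (⟺-sym (U′-off a y p))
      ... | yes p = ⟺-trans (UP-on a y p) (⟺-trans (⊎-cong ⟺-refl ((λ r → ⊥-elim (proj₁ r ps)) , λ r → ⊥-elim (proj₁ r ps))) (⟺-sym (U′-on a y p)))

      nonψ-ty : ∀ (T : D → Ty k → Set) (U : Fin k → D → Set) → (∀ y σ → Good y σ → T y σ) → (∀ y σ → T y σ → HasColour V σ y) →
        (∀ a y → a ∉ B → U a y ⟺ V a y) → (∀ y → ¬ ψS y → ∀ b → b ∈ B → U b y ⟺ Selected (T y) Ext b) →
        ∀ y → ¬ ψS y → Σ (Ty k) λ σ → σ ∈ₗ Ext × HasTy (model D U) σ y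
      nonψ-ty T U gT Tc Uoff Unp y nps with αψ y
      ... | inj₂ ps = ⊥-elim (nps ps)
      ... | inj₁ (σ , m₀ , c , p) with first-selected (T y) Ext (σ , m₀ , gT y σ (c , p))
      ...   | σ₁ , m₁ , t₁ , hs = σ₁ , m₁ , λ a → f a (em {a ∈ B})
        where f : ∀ a → Dec (a ∈ B) → U a y ⟺ (lookup σ₁ a ≡ true)
              f a (yes p′) = ⟺-trans (Unp y nps a p′) (hs a)
              f a (no p′) = ⟺-trans (Uoff a y p′) (Tc y σ₁ t₁ a p′)

      ty₁ : ∀ y → ¬ ψS y → Σ (Ty k) λ σ → σ ∈ₗ Ext × HasTy (model D UP) σ y
      ty₁ = nonψ-ty (λ y σ → Coloured y σ) UP (λ y σ g → proj₁ g) (λ y σ c → c) UP-off (λ y nps b p → S₁.nonpsi-ty y nps b p)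
      ty₂ : ∀ y → ¬ ψS y → Σ (Ty k) λ σ → σ ∈ₗ Ext × HasTy (model D U′) σ y
      ty₂ = nonψ-ty Good U′ (λ y σ g → g) (λ y σ g → proj₁ g) U′-off (λ y nps b p → S₂.nonpsi-ty y nps b p)

      inExt : ∀ (U : Fin k → D → Set) τ y → (∀ y → ¬ ψS y → Σ (Ty k) λ σ → σ ∈ₗ Ext × HasTy (model D U) σ y) →
        ¬ ψS y → HasTy (model D U) τ y → τ ∈ₗ Ext
      inExt U τ y tyf nps ht = let (σ , m₀ , hσ) = tyf y nps in subst (_∈ₗ Ext) (sym (hasTy-unique (model D U) τ σ y ht hσ)) m₀

      hasTy-same : ∀ τ y → ψS y → HasTy (model D UP) τ y ⟺ HasTy (model D U′) τ y
      hasTy-same τ y ps = Π-cong λ a → (λ f → ⟺-trans (⟺-sym (same-ψ y ps a)) f) , (λ f → ⟺-trans (same-ψ y ps a) f)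

      cnt : ∀ τ → CountEq q (HasTy (model D UP) τ) (HasTy (model D U′) τ)
      cnt τ with em {τ ∈ₗ Ext}
      ... | no nE = CountEq-cong (λ _ → ⟺-refl) (λ y → f y (em {ψS y})) CountEq-refl
        where f : ∀ y → Dec (ψS y) → HasTy (model D UP) τ y ⟺ HasTy (model D U′) τ y
              f y (yes ps) = hasTy-same τ y ps
              f y (no nps) = (λ ht → ⊥-elim (nE (inExt UP τ y ty₁ nps ht))) , λ ht → ⊥-elim (nE (inExt U′ τ y ty₂ nps ht))
      ... | yes iE with count-positions τ NL q (lookupA wf iE)
      ...   | f , finj , fp = (λ j le → (λ _ → am₂ j le) , λ _ → am₁ j le) ,
              (λ fn → Finite-∪ (λ y ht → g₁ y ht (em {ψS y})) fn finψ) ,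
              (λ fn → Finite-∪ (λ y ht → g₂ y ht (em {ψS y})) fn finψ)
        where
          colN : ∀ i → HasColour V (nty i) (h i)
          colN i = proj₁ (nOK i)
          at₁ : AtLeast q (HasTy (model D UP) τ)
          at₁ = (λ r → h (f r)) , (λ r r′ e → finj r r′ (inj _ _ e)) , λ r → subst (λ v → HasTy (model D UP) v (h (f r))) (fp r) (S₁.named-ty inj colN (f r))
          at₂ : AtLeast q (HasTy (model D U′) τ)
          at₂ = (λ r → h (f r)) , (λ r r′ e → finj r r′ (inj _ _ e)) , λ r → subst (λ v → HasTy (model D U′) v (h (f r))) (fp r) (S₂.named-ty inj colN (f r))
          am₁ : ∀ j → j ≤ q → AtLeast j (HasTy (model D UP) τ)
          am₁ j le = AtLeast-mono {P = HasTy (model D UP) τ} le at₁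
          am₂ : ∀ j → j ≤ q → AtLeast j (HasTy (model D U′) τ)
          am₂ j le = AtLeast-mono {P = HasTy (model D U′) τ} le at₂
          g₁ : ∀ y → HasTy (model D U′) τ y → Dec (ψS y) → HasTy (model D UP) τ y ⊎ ¬ ψS y
          g₁ y ht (yes ps) = inj₁ (proj₂ (hasTy-same τ y ps) ht)
          g₁ y ht (no nps) = inj₂ nps
          g₂ : ∀ y → HasTy (model D UP) τ y → Dec (ψS y) → HasTy (model D U′) τ y ⊎ ¬ ψS y
          g₂ y ht (yes ps) = inj₁ (proj₁ (hasTy-same τ y ps) ht)
          g₂ y ht (no nps) = inj₂ nps

      sim : Similar q (model D UP) (model D U′) (λ ()) (λ ())
      sim = (λ ()) , (λ ()) , λ τ → CountEq-cong (λ d → ⟺-sym (Outside₀ (model D UP) τ _ d)) (λ d → ⟺-sym (Outside₀ (model D U′) τ _ d)) (cnt τ)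

      satU′ : Sat₀ (model D U′) φ
      satU′ = proj₁ (Sat-cong (model D U′) (λ ()) φ) (EhrenfeuchtFraisse.Similar⇒Sat em (model D UP) (model D U′) φ q dq sim satUP)

      le : U′ ≤[ B ] V
      le = overrideB-≤ B U′ᴮ V λ b p y →
        [ (λ { (i , l , e) → subst (V b) (sym e) (proj₂ (nOK i) b p l) }) ,
          (λ r → let (σ , _ , (c , po) , l) = Selected-witness (Good y) Ext b (proj₂ r) in po b p l) ]

      goal : Sat₀ (model D V) φ
      goal = mon D U′ V _ satU′ le

    result : Sat₀ (model D V) (disjunctME φ) → Sat₀ (model D V) φ
    result with wf?
    ... | yes wf = λ s → let (h , sat) = proj₁ (existsN-sat (model D V) m (body φ)) s in Witnessed.goal wf h sat
    ... | no _ = λ ()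

map-pair₁ : ∀ {X Y : Set} (τ : Y) (xs : List X) → map proj₁ (map (λ d → d , τ) xs) ≡ xs
map-pair₁ τ [] = refl
map-pair₁ τ (x ∷ xs) = cong (x ∷_) (map-pair₁ τ xs)

cnt-pair : ∀ {k} {X : Set} (τ : Vec Bool k) (xs : List X) → count τ (map proj₂ (map (λ d → d , τ) xs)) ≡ length xs
cnt-pair τ [] = refl
cnt-pair τ (x ∷ xs) with ≡-dec _≟B_ τ τ
... | yes _ = cong suc (cnt-pair τ xs)
... | no ne = ⊥-elim (ne refl)

cnt-concat : ∀ {k} {A X : Set} (σ : Vec Bool k) (g : A → List (X × Vec Bool k)) (as : List A) {a} → a ∈ₗ as →
  count σ (map proj₂ (g a)) ≤ count σ (map proj₂ (concatMap g as))
cnt-concat σ g (b ∷ as) (here refl) rewrite map-++ proj₂ (g b) (concatMap g as) | sym (count-++ σ (map proj₂ (g b)) (map proj₂ (concatMap g as))) = m≤m+n _ _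
cnt-concat σ g (b ∷ as) (there m) rewrite map-++ proj₂ (g b) (concatMap g as) | sym (count-++ σ (map proj₂ (g b)) (map proj₂ (concatMap g as))) =
  ≤-trans (cnt-concat σ g as m) (m≤n+m _ _)

module ContinuousME (em : ExcludedMiddle 0ℓ) {k : ℕ} (B : Subset k) where
  open Classical em
  open TypeFormulas B
  open TranslationME B
  open DisjunctSemantics em B
  open EhrenfeuchtFraisse em using (Similar⇒Sat)
  open TypeOf em
  open Enumeration em using (enumerate-small)

  module Continuous⇒tE (φ : Sentence k MEinf) (cnt : Continuous B φ) (D : Set) (V : Fin k → D → Set) (sat : Sat₀ (model D V) φ) where
    q : ℕ
    q = depth φ

    shrunk : Σ (Valuation k D) λ U → U ≤ω[ B ] V × Sat₀ (model D U) φ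
    shrunk = proj₂ cnt D V (λ ()) sat
    U : Fin k → D → Set
    U = proj₁ shrunk
    U⊆V : ∀ b → b ∈ B → ∀ e → U b e → V b e
    U⊆V = proj₁ (proj₁ (proj₁ (proj₂ shrunk)))
    U≈V : ∀ a → a ∉ B → ∀ e → U a e ⟺ V a e
    U≈V a p e = ⇔→⟺ (proj₂ (proj₁ (proj₁ (proj₂ shrunk))) a p e)
    satU : Sat₀ (model D U) φ
    satU = proj₂ (proj₂ shrunk)

    bSupport : List D
    bSupport = proj₁ (≤ω-B-support-finite (proj₁ (proj₂ shrunk)))

    ∈bSupport : ∀ b → b ∈ B → ∀ e → U b e → e ∈ₗ bSupport
    ∈bSupport b p e u = proj₂ (≤ω-B-support-finite (proj₁ (proj₂ shrunk))) e (b , p , u)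

    𝔘 : Model k
    𝔘 = model D U
    HU : Ty k → D → Set
    HU = HasTy 𝔘
    tyU : D → Ty k
    tyU = typeOf 𝔘
    tyU-ok : ∀ d → HU (tyU d) d
    tyU-ok = typeOf-HasTy 𝔘

    Large : Ty k → Set
    Large τ = AtLeast q (HU τ)
    HasB : Ty k → Set
    HasB τ = Σ (Fin k) λ b → b ∈ B × lookup τ b ≡ true

    block′ : (τ : Ty k) → Dec (Large τ) → Dec (HasB τ) → List (D × Ty k)
    block′ τ (no nl) _ = map (λ d → d , τ) (proj₁ (enumerate-small (HU τ) q nl))
    block′ τ (yes L) (yes _) = map (λ d → d , τ) (List.tabulate {n = q} (proj₁ L))
    block′ τ (yes _) (no _) = []

    block : Ty k → List (D × Ty k)
    block τ = block′ τ em em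

    namedList : List (D × Ty k)
    namedList = concatMap block allTypes

    NL₀ Ext₀ Big₀ : List (Ty k)
    NL₀ = map proj₂ namedList
    Ext₀ = filter (λ τ → em {Large τ × HasB τ}) allTypes
    Big₀ = filter (λ τ → em {Large τ × ¬ HasB τ}) allTypes

    ι : Profile
    ι = NL₀ , Ext₀ , Big₀

    Ext-∈ : ∀ τ → Large τ → HasB τ → τ ∈ₗ Ext₀
    Ext-∈ τ l b = ∈-filter⁺ (λ τ → em {Large τ × HasB τ}) (allVecs-complete τ) (l , b)
    Ext-∈⁻ : ∀ {τ} → τ ∈ₗ Ext₀ → Large τ × HasB τ
    Ext-∈⁻ m = proj₂ (∈-filter⁻ (λ τ → em {Large τ × HasB τ}) {xs = allTypes} m)
    Big-∈ : ∀ τ → Large τ → ¬ HasB τ → τ ∈ₗ Big₀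
    Big-∈ τ l b = ∈-filter⁺ (λ τ → em {Large τ × ¬ HasB τ}) (allVecs-complete τ) (l , b)
    Big-∈⁻ : ∀ {τ} → τ ∈ₗ Big₀ → Large τ × ¬ HasB τ
    Big-∈⁻ m = proj₂ (∈-filter⁻ (λ τ → em {Large τ × ¬ HasB τ}) {xs = allTypes} m)

    BlockProp : Ty k → D × Ty k → Set
    BlockProp τ p = proj₂ p ≡ τ × HU τ (proj₁ p) × ((¬ Large τ) ⊎ (Large τ × HasB τ))

    block′-prop : ∀ τ x y p → p ∈ₗ block′ τ x y → BlockProp τ p
    block′-prop τ (no nl) y p m with ∈-map⁻ _ m
    ... | d , md , refl = refl , proj₂ (proj₁ (proj₂ (proj₂ (enumerate-small (HU τ) q nl))) d) md , inj₁ nl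
    block′-prop τ (yes L) (yes b) p m with ∈-map⁻ _ m
    ... | d , md , refl = refl , (let (i , e) = ∈-tabulate⁻ md in subst (HU τ) (sym e) (proj₂ (proj₂ L) i)) , inj₂ (L , b)
    block′-prop τ (yes L) (no _) p ()

    namedList-prop : ∀ p → p ∈ₗ namedList → BlockProp (proj₂ p) p
    namedList-prop p m with ∈-concatMap⁻ block allTypes m
    ... | τ , _ , mp with block′-prop τ em em p mp
    ...   | refl , r = refl , r

    block′-length : ∀ τ x y → length (block′ τ x y) ≤ q
    block′-length τ (no nl) y rewrite length-map (λ d → d , τ) (proj₁ (enumerate-small (HU τ) q nl)) = <⇒≤ (proj₂ (proj₂ (proj₂ (enumerate-small (HU τ) q nl))))
    block′-length τ (yes L) (yes b) rewrite length-map (λ d → d , τ) (List.tabulate {n = q} (proj₁ L)) = ≤-reflexive (length-tabulate _)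
    block′-length τ (yes L) (no _) = z≤n

    block′-distinct : ∀ τ x y → Distinct (map proj₁ (block′ τ x y))
    block′-distinct τ (no nl) y rewrite map-pair₁ τ (proj₁ (enumerate-small (HU τ) q nl)) = proj₁ (proj₂ (enumerate-small (HU τ) q nl))
    block′-distinct τ (yes L) (yes b) rewrite map-pair₁ τ (List.tabulate {n = q} (proj₁ L)) = tabulate-Distinct q _ (proj₁ (proj₂ L))
    block′-distinct τ (yes L) (no _) = tt

    namedList-distinct : Distinct (map proj₁ namedList)
    namedList-distinct rewrite map-concatMap proj₁ block allTypes =
      Distinct-concatMap _ allTypes (Distinct-allVecs k) (λ τ → block′-distinct τ em em) λ τ σ x m₁ m₂ →
        let (p₁ , mp₁ , e₁) = ∈-map⁻ proj₁ m₁ ; (p₂ , mp₂ , e₂) = ∈-map⁻ proj₁ m₂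
            (_ , h₁ , _) = block′-prop τ em em p₁ mp₁ ; (_ , h₂ , _) = block′-prop σ em em p₂ mp₂
        in hasTy-unique 𝔘 τ σ x (subst (HU τ) (sym e₁) h₁) (subst (HU σ) (sym e₂) h₂)

    small-∈′ : ∀ y (x : Dec (Large (tyU y))) z → ¬ Large (tyU y) → (y , tyU y) ∈ₗ block′ (tyU y) x z
    small-∈′ y (no nl) z _ = ∈-map⁺ _ (proj₁ (proj₁ (proj₂ (proj₂ (enumerate-small (HU (tyU y)) q nl))) y) (tyU-ok y))
    small-∈′ y (yes L) z nl = ⊥-elim (nl L)

    small-∈ : ∀ y → ¬ Large (tyU y) → (y , tyU y) ∈ₗ namedList
    small-∈ y nl = ∈-concatMap block allTypes (allVecs-complete (tyU y)) (small-∈′ y em em nl)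

    m : ℕ
    m = length NL₀
    h : Fin m → D
    h i = proj₁ (lookupP namedList i)

    open Disjunct q ι using (nty; WF; wf?; body; disjunctME; Δ)

    nty-eq : ∀ i → nty i ≡ proj₂ (lookupP namedList i)
    nty-eq i = lookupP-snd namedList i

    inj : ∀ i j → h i ≡ h j → i ≡ j
    inj = lookupP-inj namedList namedList-distinct

    named-HU : ∀ i → HU (nty i) (h i)
    named-HU i with namedList-prop (lookupP namedList i) (lookupP-∈ namedList i)
    ... | _ , hu , _ = subst (λ v → HU v (h i)) (sym (nty-eq i)) hu

    named-cls : ∀ i → (¬ Large (nty i)) ⊎ (Large (nty i) × HasB (nty i))
    named-cls i with namedList-prop (lookupP namedList i) (lookupP-∈ namedList i)
    ... | _ , _ , c = subst (λ v → (¬ Large v) ⊎ (Large v × HasB v)) (sym (nty-eq i)) c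

    small-named : ∀ y → ¬ Large (tyU y) → Σ (Fin m) λ i → y ≡ h i × nty i ≡ tyU y
    small-named y nl with lookupP-idx namedList (small-∈ y nl)
    ... | i , e = i , cong proj₁ (sym e) , trans (nty-eq i) (cong proj₂ e)

    HasTy⇒HasColour : ∀ τ d → HU τ d → HasColour V τ d
    HasTy⇒HasColour τ d hu a p = ⟺-trans (⟺-sym (U≈V a p d)) (hu a)
    HasTy⇒HasBPart : ∀ τ d → HU τ d → HasBPart V τ d
    HasTy⇒HasBPart τ d hu b p l = U⊆V b p d (proj₂ (hu b) l)

    block-count : ∀ σ → (x : Dec (Large σ)) (y : Dec (HasB σ)) → Large σ → HasB σ → q ≤ count σ (map proj₂ (block′ σ x y))
    block-count σ (no nl) y L b = ⊥-elim (nl L)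
    block-count σ (yes L′) (no nb) L b = ⊥-elim (nb b)
    block-count σ (yes L′) (yes _) L b = ≤-reflexive (sym (trans (cnt-pair σ (List.tabulate {n = q} (proj₁ L′))) (length-tabulate (proj₁ L′))))

    well-formed : WF
    well-formed = tabulateA λ {σ} mσ → let (L , b) = Ext-∈⁻ mσ in
      ≤-trans (block-count σ em em L b) (cnt-concat σ block allTypes (allVecs-complete σ))

    open DisjunctAt q ι V h
    module S₁ = NamedShape (λ y → Selected (Coloured y) Ext₀) UP UP-on UP-off
    open SubstituteB.Semantics B m Δ em using (substB-sat)

    colN : ∀ i → HasColour V (nty i) (h i)
    colN i = HasTy⇒HasColour (nty i) (h i) (named-HU i)

    HUP : Ty k → D → Set
    HUP = HasTy (model D UP)

    named-HUP : ∀ i → HUP (nty i) (h i)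
    named-HUP = S₁.named-ty inj colN

    Cls : D → Set
    Cls y = (Σ (Fin m) λ i → y ≡ h i) ⊎ ((Large (tyU y) × HasB (tyU y)) ⊎ (Large (tyU y) × ¬ HasB (tyU y)))

    cls : ∀ y → Cls y
    cls y = f (em {Large (tyU y)}) (em {HasB (tyU y)})
      where f : Dec (Large (tyU y)) → Dec (HasB (tyU y)) → Cls y
            f (no nl) _ = inj₁ (let (i , e , _) = small-named y nl in i , e)
            f (yes L) (yes b) = inj₂ (inj₁ (L , b))
            f (yes L) (no nb) = inj₂ (inj₂ (L , nb))

    αψ-everywhere : ∀ y → Sat (model D V) (ext h y) (Disjunct.αF q ι) ⊎ Sat (model D V) (ext h y) (Disjunct.ψF q ι)
    αψ-everywhere y with cls y
    ... | inj₁ ie = inj₂ (proj₂ (ψ-sat y) (inj₁ ie))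
    ... | inj₂ (inj₁ (L , b)) = inj₁ (proj₂ (α-sat y) (tyU y , Ext-∈ _ L b , HasTy⇒HasColour (tyU y) y (tyU-ok y) , HasTy⇒HasBPart (tyU y) y (tyU-ok y)))
    ... | inj₂ (inj₂ (L , nb)) = inj₂ (proj₂ (ψ-sat y) (inj₂ (tyU y , Big-∈ _ L nb , HasTy⇒HasColour (tyU y) y (tyU-ok y))))

    ψ-off-bSupport : ∀ y → ¬ y ∈ₗ bSupport → ψS y
    ψ-off-bSupport y nb with cls y
    ... | inj₁ ie = inj₁ ie
    ... | inj₂ (inj₁ (L , (b , p , l))) = ⊥-elim (nb (∈bSupport b p y (proj₂ (tyU-ok y b) l)))
    ... | inj₂ (inj₂ (L , nbn)) = inj₂ (tyU y , Big-∈ _ L nbn , HasTy⇒HasColour (tyU y) y (tyU-ok y))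

    ψ-cofinite : Finite (λ y → ¬ Sat (model D V) (ext h y) (Disjunct.ψF q ι))
    ψ-cofinite = bSupport , λ y nψ → f y nψ (em {y ∈ₗ bSupport})
      where f : ∀ y → ¬ Sat (model D V) (ext h y) (Disjunct.ψF q ι) → Dec (y ∈ₗ bSupport) → y ∈ₗ bSupport
            f y nψ (yes mb) = mb
            f y nψ (no nb) = ⊥-elim (nψ (proj₂ (ψ-sat y) (ψ-off-bSupport y nb)))

    nonψ : ∀ y → ¬ ψS y → Σ (Ty k) λ σ → σ ∈ₗ Ext₀ × HUP σ y
    nonψ y nps with αψ-everywhere y
    ... | inj₂ s = ⊥-elim (nps (proj₁ (ψ-sat y) s))
    ... | inj₁ s with proj₁ (α-sat y) s
    ...   | σ , mσ , c , _ with first-selected (Coloured y) Ext₀ (σ , mσ , c)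
    ...     | σ₁ , m₁ , c₁ , hs = σ₁ , m₁ , λ a → f a (em {a ∈ B})
      where f : ∀ a → Dec (a ∈ B) → UP a y ⟺ (lookup σ₁ a ≡ true)
            f a (yes p) = ⟺-trans (S₁.nonpsi-ty y nps a p) (hs a)
            f a (no p) = ⟺-trans (UP-off a y p) (c₁ a p)

    same-off-bSupport : ∀ y → ¬ y ∈ₗ bSupport → ∀ a → U a y ⟺ UP a y
    same-off-bSupport y nb a with em {a ∈ B}
    ... | no p = ⟺-trans (U≈V a p y) (⟺-sym (UP-off a y p))
    ... | yes p with em {Σ (Fin m) λ i → y ≡ h i}
    ...   | yes (i , refl) = ⟺-trans (named-HU i a) (⟺-sym (named-HUP i a))
    ...   | no nn = (λ u → ⊥-elim (nb (∈bSupport a p y u))) , λ u → ⊥-elim (S₁.psi-ty y (ψ-off-bSupport y nb) nn a p u)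

    CountEq-small : ∀ τ → ¬ Large τ → CountEq q (HU τ) (HUP τ)
    CountEq-small τ nl = CountEq-cong (λ _ → ⟺-refl) (λ y → to y , fr y) CountEq-refl
      where
        to : ∀ y → HU τ y → HUP τ y
        to y hu with hasTy-unique 𝔘 τ (tyU y) y hu (tyU-ok y)
        ... | refl with small-named y nl
        ...   | i , refl , e = subst (λ v → HUP v (h i)) e (named-HUP i)
        fr′ : ∀ y → HUP τ y → Dec (Σ (Fin m) λ i → y ≡ h i) → Dec (ψS y) → HU τ y
        fr′ y hup (yes (i , refl)) _ = subst (λ v → HU v (h i)) (sym (hasTy-unique (model D UP) τ (nty i) (h i) hup (named-HUP i))) (named-HU i)
        fr′ y hup (no nn) (no nps) = let (σ , mσ , hσ) = nonψ y nps in
          ⊥-elim (nl (subst Large (sym (hasTy-unique (model D UP) τ σ y hup hσ)) (proj₁ (Ext-∈⁻ mσ))))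
        fr′ y hup (no nn) (yes (inj₁ ie)) = ⊥-elim (nn ie)
        fr′ y hup (no nn) (yes ps@(inj₂ (σ , mσ , c))) =
          ⊥-elim (nl (subst Large (sym (hasTy-unique (model D UP) τ σ y hup hσ)) (proj₁ (Big-∈⁻ mσ))))
          where hσ : HUP σ y
                hσ a with em {a ∈ B}
                ... | no p = ⟺-trans (UP-off a y p) (c a p)
                ... | yes p = (λ u → ⊥-elim (S₁.psi-ty y ps nn a p u)) , λ l → ⊥-elim (proj₂ (Big-∈⁻ mσ) (a , p , l))
        fr : ∀ y → HUP τ y → HU τ y
        fr y hup = fr′ y hup em em

    CountEq-large : ∀ τ → Large τ → CountEq q (HU τ) (HUP τ)
    CountEq-large τ L = (λ j le → (λ _ → AtLeast-mono {P = HUP τ} le atP) , λ _ → AtLeast-mono {P = HU τ} le L) ,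
                  (λ fn → Finite-∪ (λ y hup → g₁ y hup (em {y ∈ₗ bSupport})) fn (bSupport , λ x m → m)) ,
                  (λ fn → Finite-∪ (λ y hu → g₂ y hu (em {y ∈ₗ bSupport})) fn (bSupport , λ x m → m))
      where
        g₁ : ∀ y → HUP τ y → Dec (y ∈ₗ bSupport) → HU τ y ⊎ (y ∈ₗ bSupport)
        g₁ y hup (yes mb) = inj₂ mb
        g₁ y hup (no nb) = inj₁ (λ a → ⟺-trans (same-off-bSupport y nb a) (hup a))
        g₂ : ∀ y → HU τ y → Dec (y ∈ₗ bSupport) → HUP τ y ⊎ (y ∈ₗ bSupport)
        g₂ y hu (yes mb) = inj₂ mb
        g₂ y hu (no nb) = inj₁ (λ a → ⟺-trans (⟺-sym (same-off-bSupport y nb a)) (hu a))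
        atP′ : Dec (HasB τ) → AtLeast q (HUP τ)
        atP′ (yes b) with count-positions τ NL₀ q (lookupA well-formed (Ext-∈ τ L b))
        ... | f , finj , fp = (λ r → h (f r)) , (λ r r′ e → finj r r′ (inj _ _ e)) ,
                              λ r → subst (λ v → HUP v (h (f r))) (fp r) (named-HUP (f r))
        atP′ (no nb) = proj₁ L , proj₁ (proj₂ L) , λ r → toP (proj₁ L r) (proj₂ (proj₂ L) r)
          where
            toP : ∀ y → HU τ y → HUP τ y
            toP y hu = hσ
              where
                nn : ¬ (Σ (Fin m) λ i → y ≡ h i)
                nn (i , refl) with named-cls i | hasTy-unique 𝔘 τ (nty i) (h i) hu (named-HU i)
                ... | inj₁ nl | e = nl (subst Large e L)
                ... | inj₂ (_ , b) | e = nb (subst HasB (sym e) b)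
                ps : ψS y
                ps = inj₂ (τ , Big-∈ τ L nb , HasTy⇒HasColour τ y hu)
                hσ : HUP τ y
                hσ a with em {a ∈ B}
                ... | no p = ⟺-trans (UP-off a y p) (HasTy⇒HasColour τ y hu a p)
                ... | yes p = (λ u → ⊥-elim (S₁.psi-ty y ps nn a p u)) , λ l → ⊥-elim (nb (a , p , l))
        atP : AtLeast q (HUP τ)
        atP = atP′ em

    count-equal : ∀ τ → CountEq q (HU τ) (HUP τ)
    count-equal τ with em {Large τ}
    ... | no nl = CountEq-small τ nl
    ... | yes L = CountEq-large τ L

    similar : Similar q 𝔘 (model D UP) (λ ()) (λ ())
    similar = (λ ()) , (λ ()) , λ τ → CountEq-cong (λ d → ⟺-sym (Outside₀ 𝔘 τ _ d)) (λ d → ⟺-sym (Outside₀ (model D UP) τ _ d)) (count-equal τ)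

    satUP : Sat (model D UP) (λ i → h (i ↑ˡ m)) φ
    satUP = proj₁ (Sat-cong (model D UP) (λ ()) φ) (Similar⇒Sat 𝔘 (model D UP) φ q ≤-refl similar satU)

    body-holds : Sat (model D V) h (body φ)
    body-holds = ((proj₂ (distinct-sat (model D V) h) inj ,
               proj₂ (⋀-sat (model D V) h _) (λ i → proj₂ (colour-sat (model D V) h (nty i) i) (colN i) ,
                                                         proj₂ (bPart-sat (model D V) h (nty i) i) (HasTy⇒HasBPart (nty i) (h i) (named-HU i)))) ,
              (αψ-everywhere , ψ-cofinite)) ,
             proj₂ (substB-sat D V h φ) satUP

    disjunct-holds : Sat₀ (model D V) (disjunctME φ)
    disjunct-holds with wf?
    ... | yes _ = proj₂ (existsN-sat (model D V) m (body φ)) (h , body-holds)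
    ... | no nw = ⊥-elim (nw well-formed)

    namedList-bound : length NL₀ ≤ length allTypes * q
    namedList-bound rewrite length-map proj₂ namedList = length-concatMap block allTypes q (λ τ → block′-length τ em em)

    profile-listed : ι ∈ₗ allProfiles q
    profile-listed = ∈-concatMap _ _ (allLists-∈ (length allTypes * q) allTypes NL₀ namedList-bound (λ x _ → allVecs-complete x))
                (∈-concatMap _ _ (filter∈sublists (λ τ → em {Large τ × HasB τ}) allTypes) (∈-map⁺ _ (filter∈sublists (λ τ → em {Large τ × ¬ HasB τ}) allTypes)))

    result : Sat₀ (model D V) (tE φ)
    result = proj₂ (⋁ₗ-sat (model D V) _ _ (allProfiles q)) (ι , profile-listed , disjunct-holds)

translation : ∀ {k} (L : Lang) → Subset k → Sentence k L → Sentence k L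
translation M B = TranslationM.tM B
translation MEinf B = TranslationME.tE B

translation-SynCont : ∀ {k} (L : Lang) (B : Subset k) (φ : Sentence k L) → SynCont B (translation L B φ)
translation-SynCont M B = TranslationM.tM-SynCont B
translation-SynCont MEinf B = TranslationME.tE-SynCont B

module _ (em : ExcludedMiddle 0ℓ) {k : ℕ} (B : Subset k) where

  translation-sound : ∀ L {φ : Sentence k L} → Monotone B φ → ∀ 𝔐 → Sat₀ 𝔐 (translation L B φ) → Sat₀ 𝔐 φ
  translation-sound M {φ} mon 𝔐 s =
    let (S , _ , s′) = proj₁ (⋁ₗ-sat 𝔐 _ (λ S → disjunctM S φ) (sublists (allVecs k))) s
    in DisjunctM⇒φ.result em S φ mon (D 𝔐) (V 𝔐) s′
    where open TranslationM B
  translation-sound MEinf {φ} mon 𝔐 s =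
    let (ι , _ , s′) = proj₁ (⋁ₗ-sat 𝔐 _ (λ ι → Disjunct.disjunctME (depth φ) ι φ) (allProfiles (depth φ))) s
    in DisjunctSemantics.DisjunctME⇒φ.result em B (depth φ) ι φ ≤-refl mon (D 𝔐) (V 𝔐) s′
    where open TranslationME B

  translation-complete : ∀ L {φ : Sentence k L} → Continuous B φ → ∀ 𝔐 → Sat₀ 𝔐 φ → Sat₀ 𝔐 (translation L B φ)
  translation-complete M {φ} c 𝔐 = TranslationM.Continuous⇒tM.result B em φ c (D 𝔐) (V 𝔐)
  translation-complete MEinf {φ} c 𝔐 = ContinuousME.Continuous⇒tE.result em B φ c (D 𝔐) (V 𝔐)

  Continuous⇒≡ₛ-translation : ∀ L {φ : Sentence k L} → Continuous B φ → φ ≡ₛ translation L B φ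
  Continuous⇒≡ₛ-translation L c 𝔐 = mk⇔ (translation-complete L c 𝔐) (translation-sound L (proj₁ c) 𝔐)

  ≡ₛ-translation⇒Continuous : ∀ L {φ : Sentence k L} → φ ≡ₛ translation L B φ → Continuous B φ
  ≡ₛ-translation⇒Continuous L {φ} φ≡tφ =
    Continuous-resp-≡ₛ em B {φ = φ} {ψ = translation L B φ} φ≡tφ (SynCont⇒Continuous em B (translation-SynCont L B φ))

proposition5p8 : (k : ℕ) (L : Lang) (B : Subset k) →
    Σ (Sentence k L → Sentence k L) λ t →
    ExcludedMiddle 0ℓ →
    ((φ : Sentence k L) → SynCont B (t φ))
    × ((φ : Sentence k L) → Continuous B φ ⇔ (φ ≡ₛ t φ))
proposition5p8 k L B = translation L B , λ em →
  translation-SynCont L B ,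
  λ φ → mk⇔ (Continuous⇒≡ₛ-translation em B L) (≡ₛ-translation⇒Continuous em B L)
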